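{- Let $a'$, $a''$, $b$ be nonempty strings of lengths $m'$, $m''$, $n$, let $a=a'a''$ and $m=m'+m''$. Let $I_{m'}$ be the offset identity matrix over $\langle -m:-m'\mid -m'':0\rangle$ and $I_{m''}$ the offset identity matrix over $\langle n:m'+n\mid m''+n:m+n\rangle$. Then $$P_{a,b}=\bigl(I_{m'}\sqcup P_{a',b}\bigr)\boxdot\bigl(P_{a'',b}\sqcup I_{m''}\bigr),$$ $$P^{\mathrm{ss}}_{a,b}=P^{\mathrm{ss}}_{a',b}\boxdot P^{\mathrm{ss}}_{a'',b},$$ $$P^{\times}_{a',a'',b}=\bigl(P^{\mathrm{sp}}_{a',b}\sqcup P^{\mathrm{ss}}_{a',b}\bigr)\boxdot\bigl(P^{\mathrm{ss}}_{a'',b}\sqcup P^{\mathrm{ps}}_{a'',b}\bigr).$$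
   Context: For integers $i\le j$, $[i:j]=\{i,\dots,j\}$ and $\langle i:j\rangle=\{i+\tfrac12,\dots,j-\tfrac12\}$. Strings are indexed by odd half-integers, $x\langle i:j\rangle=x(i+\tfrac12)\cdots x(j-\tfrac12)$. A wildcard $\diamond$ matches every character; LCS score = maximum length of a common subsequence under this matching. For strings $x$ of length $p$ and $y$ of length $q$, let $c=\diamond^p y\,\diamond^p$ indexed by $\langle -p:p+q\rangle$ ($c(\hat k)=y(\hat k)$ for $\hat k\in\langle 0:q\rangle$, $\diamond$ otherwise); the semi-local score matrix $H_{x,y}$ over $[-p:q\mid 0:p+q]$ is $H_{x,y}(i,j)=$ LCS score of $x$ and $c\langle i:j\rangle$ for $i\le j$, and $j-i$ for $j<i$. For $D$ over $\langle i_0:i_1\mid j_0:j_1\rangle$, $D^\Sigma(i,j)=\sum_{\hat\imath\in\langle i:i_1\rangle,\hat\jmath\in\langle j_0:j\rangle}D(\hat\imath,\hat\jmath)$. The semi-local seaweed matrix $P_{x,y}$ is the (unique) permutation matrix over $\langle -p:q\mid 0:p+q\rangle$ with $H_{x,y}(i,j)=j-i-P_{x,y}^\Sigma(i,j)$ for all $i,j$. Its submatrices are: string-substring $P^{\mathrm{ss}}_{x,y}=P_{x,y}\langle 0:q\mid 0:q\rangle$, prefix-suffix $P^{\mathrm{ps}}_{x,y}=P_{x,y}\langle 0:q\mid q:p+q\rangle$, suffix-prefix $P^{\mathrm{sp}}_{x,y}=P_{x,y}\langle -p:0\mid 0:q\rangle$, substring-string $P^{\mathrm{Ss}}_{x,y}=P_{x,y}\langle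 -p:0\mid q:p+q\rangle$. For $a=a'a''$, the seaweed cross-matrix is $P^{\times}_{a',a'',b}=P_{a,b}\langle -m':n\mid 0:m''+n\rangle$. An offset identity matrix over $\langle i_0:i_1\mid j_0:j_1\rangle$ with $j_0-i_0=j_1-i_1=h$ has entry $1$ at $(\hat\imath,\hat\jmath)$ iff $\hat\jmath-\hat\imath=h$, and $0$ otherwise. For matrices $A'$ over $(I'\mid J')$ and $A''$ over $(I''\mid J'')$ with $(I'\times J')\cap(I''\times J'')=\emptyset$, the disjoint union $A'\sqcup A''$ over $(I'\cup I''\mid J'\cup J'')$ equals $A'$ on $I'\times J'$, $A''$ on $I''\times J''$, and $0$ elsewhere. For (sub)permutation matrices $P_A$ over $\langle i_0:i_1\mid j_0:j_1\rangle$ and $P_B$ over $\langle j_0:j_1\mid k_0:k_1\rangle$, the implicit distance product $P_A\boxdot P_B$ is the (sub)permutation matrix $P_C$ over $\langle i_0:i_1\mid k_0:k_1\rangle$ with $P_C^\Sigma(i,k)=\min_{j\in[j_0:j_1]}(P_A^\Sigma(i,j)+P_B^\Sigma(j,k))$ for all $i,k$. -}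

module Defs where

open import Data.Bool using (Bool; true; false; if_then_else_; _∧_)
open import Data.Nat as ℕ using (ℕ; zero; suc)
open import Data.Integer as ℤ
  using (ℤ; +_; -[1+_]; -_; _+_; _-_; _⊓_; _⊔_; _≤_; _<_; ∣_∣; 0ℤ; 1ℤ; _≤ᵇ_)
open import Data.List using (List; []; _∷_; map; length)
open import Data.Maybe using (Maybe; just; nothing)
open import Data.Product using (Σ; _×_; ∃-syntax)
open import Data.Sum using (_⊎_)
open import Data.Unit using (⊤)
open import Relation.Binary.PropositionalEquality using (_≡_)

-- A padded character: nothing = wildcard ◇, just a = ordinary character a.
-- Matching: ◇ matches every character, otherwise characters must be equal.
Match : {A : Set} → A → Maybe A → Set
Match a nothing  = ⊤
Match a (just b) = a ≡ b

data CommonSub {A : Set} : List A → List (Maybe A) → ℕ → Set where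
  done  : CommonSub [] [] 0
  skipL : ∀ {a u v k} → CommonSub u v k → CommonSub (a ∷ u) v k
  skipR : ∀ {c u v k} → CommonSub u v k → CommonSub u (c ∷ v) k
  take  : ∀ {a c u v k} → Match a c → CommonSub u v k →
          CommonSub (a ∷ u) (c ∷ v) (suc k)

IsLCS : {A : Set} → List A → List (Maybe A) → ℕ → Set
IsLCS u v k = CommonSub u v k × (∀ k′ → CommonSub u v k′ → k′ ℕ.≤ k)

-- Integer ranges.  A half-integer  i + 1/2  is represented by the integer i.

len : ℤ → ℤ → ℕ
len lo hi = ∣ (hi - lo) ⊔ 0ℤ ∣

sumN : (ℤ → ℤ) → ℤ → ℕ → ℤ
sumN f lo zero    = 0ℤ
sumN f lo (suc n) = f lo + sumN f (lo + 1ℤ) n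

sumR : (ℤ → ℤ) → ℤ → ℤ → ℤ
sumR f lo hi = sumN f lo (len lo hi)

minN : (ℤ → ℤ) → ℤ → ℕ → ℤ
minN f lo zero    = f lo
minN f lo (suc n) = f lo ⊓ minN f (lo + 1ℤ) n

-- minimum of f over the integer range [lo:hi]  (lo ≤ hi)
minR : (ℤ → ℤ) → ℤ → ℤ → ℤ
minR f lo hi = minN f lo (len lo hi)

rangeL : ℤ → ℕ → List ℤ
rangeL lo zero    = []
rangeL lo (suc n) = lo ∷ rangeL (lo + 1ℤ) n

-- Matrices over ⟨r0:r1 | c0:c1⟩ ; ent r c is the entry at (r+1/2, c+1/2)

record Mat : Set where
  constructor mat
  field
    r0 r1 c0 c1 : ℤ
    ent : ℤ → ℤ → ℤ
open Mat public

distΣ : Mat → ℤ → ℤ → ℤ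
distΣ D i j = sumR (λ r → sumR (λ c → ent D r c) (c0 D) j) i (r1 D)

ZeroOne : Mat → Set
ZeroOne D = ∀ r c → r0 D ≤ r → r < r1 D → c0 D ≤ c → c < c1 D →
            (ent D r c ≡ 0ℤ) ⊎ (ent D r c ≡ 1ℤ)

rowSum : Mat → ℤ → ℤ
rowSum D r = sumR (λ c → ent D r c) (c0 D) (c1 D)

colSum : Mat → ℤ → ℤ
colSum D c = sumR (λ r → ent D r c) (r0 D) (r1 D)

IsPerm : Mat → Set
IsPerm D = ZeroOne D
         × (∀ r → r0 D ≤ r → r < r1 D → rowSum D r ≡ 1ℤ)
         × (∀ c → c0 D ≤ c → c < c1 D → colSum D c ≡ 1ℤ)

IsSubPerm : Mat → Set
IsSubPerm D = ZeroOne D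
         × (∀ r → r0 D ≤ r → r < r1 D → rowSum D r ≤ 1ℤ)
         × (∀ c → c0 D ≤ c → c < c1 D → colSum D c ≤ 1ℤ)

sub : Mat → ℤ → ℤ → ℤ → ℤ → Mat
sub D i0 i1 j0 j1 = mat i0 i1 j0 j1 (ent D)

inRange : ℤ → ℤ → ℤ → Bool
inRange lo hi x = (lo ≤ᵇ x) ∧ (x + 1ℤ ≤ᵇ hi)

eqᵇ : ℤ → ℤ → Bool
eqᵇ x y = (x ≤ᵇ y) ∧ (y ≤ᵇ x)

offId : ℤ → ℤ → ℤ → ℤ → Mat
offId i0 i1 j0 j1 = mat i0 i1 j0 j1
  (λ r c → if eqᵇ (c - r) (j0 - i0) then 1ℤ else 0ℤ)

-- disjoint union A′ ⊔ A″ (the index sets used are intervals whose unions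
-- are again intervals, so the union is described by min/max of the bounds)
_⊔ᴹ_ : Mat → Mat → Mat
A′ ⊔ᴹ A″ = mat (r0 A′ ⊓ r0 A″) (r1 A′ ⊔ r1 A″) (c0 A′ ⊓ c0 A″) (c1 A′ ⊔ c1 A″)
  (λ r c → if inRange (r0 A′) (r1 A′) r ∧ inRange (c0 A′) (c1 A′) c
           then ent A′ r c
           else if inRange (r0 A″) (r1 A″) r ∧ inRange (c0 A″) (c1 A″) c
           then ent A″ r c
           else 0ℤ)

IsDistProd : Mat → Mat → Mat → Set
IsDistProd A B C =
    (c0 A ≡ r0 B) × (c1 A ≡ r1 B)
  × (r0 C ≡ r0 A) × (r1 C ≡ r1 A) × (c0 C ≡ c0 B) × (c1 C ≡ c1 B)
  × IsSubPerm C
  × (∀ i k → r0 A ≤ i → i ≤ r1 A → c0 B ≤ k → k ≤ c1 B →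
       distΣ C i k ≡ minR (λ j → distΣ A i j + distΣ B j k) (c0 A) (c1 A))

nth : {A : Set} → List A → ℕ → Maybe A
nth []       n       = nothing
nth (x ∷ xs) zero    = just x
nth (x ∷ xs) (suc n) = nth xs n

-- c = ◇^p y ◇^p ; cAt y k = c(k + 1/2)  (for k in the range ⟨-p : p+q⟩)
cAt : {A : Set} → List A → ℤ → Maybe A
cAt y (+ n)    = nth y n
cAt y -[1+ n ] = nothing

subC : {A : Set} → List A → ℤ → ℤ → List (Maybe A)
subC y i j = map (cAt y) (rangeL i (len i j))

HScore : {A : Set} → List A → List A → ℤ → ℤ → ℤ → Set
HScore x y i j h =
    (i ≤ j × ∃[ k ] (IsLCS x (subC y i j) k × h ≡ + k))
  ⊎ (j < i × h ≡ j - i)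

swMat : {A : Set} → List A → List A → (ℤ → ℤ → ℤ) → Mat
swMat x y f = mat (- + length x) (+ length y) 0ℤ (+ length x + + length y) f

IsSeaweed : {A : Set} → List A → List A → (ℤ → ℤ → ℤ) → Set
IsSeaweed x y f =
  IsPerm (swMat x y f)
  × (∀ i j → - + length x ≤ i → i ≤ + length y →
             0ℤ ≤ j → j ≤ + length x + + length y →
             HScore x y i j (j - i - distΣ (swMat x y f) i j))

Pss Pps Psp PSs : {A : Set} → List A → List A → (ℤ → ℤ → ℤ) → Mat
Pss x y f = sub (swMat x y f) 0ℤ (+ length y) 0ℤ (+ length y)
Pps x y f = sub (swMat x y f) 0ℤ (+ length y) (+ length y) (+ length x + + length y)
Psp x y f = sub (swMat x y f) (- + length x) 0ℤ 0ℤ (+ length y)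
PSs x y f = sub (swMat x y f) (- + length x) 0ℤ (+ length y) (+ length x + + length y)

-- seaweed cross-matrix P×_{a′,a″,b} = P_{a,b}⟨-m′:n | 0:m″+n⟩ where f = P_{a′a″,b}
Pcross : {A : Set} → List A → List A → List A → (ℤ → ℤ → ℤ) → Mat
Pcross a′ a″ b f = mat (- + length a′) (+ length b) 0ℤ (+ length a″ + + length b) f

module Submission where

-- D(i,j) = (j − i) − H(i,j), the deficit of a semi-local score, is the distribution matrix P^Σ of
-- the seaweed matrix. Cutting an optimal common subsequence of a′a″ and a window c⟨i:k⟩ where a′ ends
-- gives a split point j with H_{a′a″}(i,k) ≤ H_{a′}(i,j) + H_{a″}(j,k), and concatenating common
-- subsequences gives the reverse inequality for every j. Hence
-- D_{a′a″}(i,k) = min_j (D_{a′}(i,j) + D_{a″}(j,k)), which is the implicit distance product; the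
-- three identities differ only in the ranges of i, j and k. For the full matrices the offset identity
-- blocks extend D_{a′} and D_{a″} to the larger index ranges, where the windows reach further into the
-- wildcard padding of b.

open import Defs
open import Data.Bool using (Bool; true; false; if_then_else_; _∧_; T)
open import Data.Bool.Properties using (∧-zeroʳ; T-≡)
open import Data.Empty using (⊥-elim)
open import Data.Integer as ℤ
  using (ℤ; +_; -[1+_]; -_; _+_; _-_; _⊓_; _⊔_; _≤_; _<_; ∣_∣; 0ℤ; 1ℤ; _≤ᵇ_; +≤+; +<+)
import Data.Integer.Properties as ℤP
open import Data.Integer.Tactic.RingSolver using (solve-∀)
open import Data.List as List using (List; []; _∷_; map; length; _++_; replicate)
import Data.List.Properties as ListP
open import Data.Maybe using (Maybe; nothing)
open import Data.Nat as ℕ using (ℕ; zero; suc; z≤n; s≤s)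
import Data.Nat.Properties as ℕP
open import Data.Product using (∃-syntax; _×_; _,_; proj₁; proj₂)
open import Data.Sum using (_⊎_; inj₁; inj₂)
open import Data.Unit using (tt)
open import Function.Bundles using (Equivalence)
open import Relation.Nullary using (yes; no)
open import Relation.Binary.PropositionalEquality

i≤j⇒∃[d]j≡i+d : ∀ {i j} → i ≤ j → ∃[ d ] j ≡ i + + d
i≤j⇒∃[d]j≡i+d {i} {j} i≤j =
  ∣ j - i ∣ , trans (j≡i+[j-i] i j) (cong (_+_ i) (sym (ℤP.0≤i⇒+∣i∣≡i (ℤP.i≤j⇒0≤j-i i≤j))))
  where j≡i+[j-i] : ∀ i j → j ≡ i + (j - i)
        j≡i+[j-i] = solve-∀

i≤i+d : ∀ i d → i ≤ i + + d
i≤i+d i d = ℤP.i≤i+j i (+ d)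

i<i+1 : ∀ i → i < i + 1ℤ
i<i+1 i = subst (_< i + 1ℤ) (ℤP.+-identityʳ i) (ℤP.+-monoʳ-< i (+<+ (s≤s z≤n)))

i+1+d≡i+[1+d] : ∀ i d → i + 1ℤ + + d ≡ i + + suc d
i+1+d≡i+[1+d] i d = trans (ℤP.+-assoc i 1ℤ (+ d)) (cong (_+_ i) (sym (ℤP.pos-+ 1 d)))

i<j⇒i+1≤j : ∀ {i j} → i < j → i + 1ℤ ≤ j
i<j⇒i+1≤j {i} {j} i<j = subst (_≤ j) (ℤP.+-comm 1ℤ i) (ℤP.i<j⇒suc[i]≤j i<j)

+-cancelˡ-≤ : ∀ i {j k} → i + j ≤ i + k → j ≤ k
+-cancelˡ-≤ i {j} {k} i+j≤i+k = subst₂ _≤_ (-i+[i+j]≡j i j) (-i+[i+j]≡j i k) (ℤP.+-monoʳ-≤ (- i) i+j≤i+k)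
  where -i+[i+j]≡j : ∀ i j → - i + (i + j) ≡ j
        -i+[i+j]≡j = solve-∀

-d≤0 : ∀ d → - (+ d) ≤ 0ℤ
-d≤0 zero    = ℤP.≤-refl
-d≤0 (suc d) = ℤ.-≤+

0≤+d : ∀ d → 0ℤ ≤ + d
0≤+d d = +≤+ z≤n

r<j-a⇒r+a<j : ∀ {r a j} → r < j - a → r + a < j
r<j-a⇒r+a<j {r} {a} {j} r<j-a = subst (r + a <_) (j-a+a≡j j a) (ℤP.+-monoˡ-< a r<j-a)
  where j-a+a≡j : ∀ j a → j - a + a ≡ j
        j-a+a≡j = solve-∀

j-a≤r⇒j≤r+a : ∀ {r a j} → j - a ≤ r → j ≤ r + a
j-a≤r⇒j≤r+a {r} {a} {j} j-a≤r = subst (_≤ r + a) (j-a+a≡j j a) (ℤP.+-monoˡ-≤ a j-a≤r)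
  where j-a+a≡j : ∀ j a → j - a + a ≡ j
        j-a+a≡j = solve-∀

len-+ : ∀ lo d → len lo (lo + + d) ≡ d
len-+ lo d =
  trans (cong (λ x → ∣ x ⊔ 0ℤ ∣) (lo+d-lo≡d lo (+ d))) (cong ∣_∣ (ℤP.i≥j⇒i⊔j≡i (+≤+ z≤n)))
  where lo+d-lo≡d : ∀ lo d → lo + d - lo ≡ d
        lo+d-lo≡d = solve-∀

+len : ∀ {i j} → i ≤ j → + len i j ≡ j - i
+len {i} {j} i≤j rewrite ℤP.i≥j⇒i⊔j≡i (ℤP.i≤j⇒0≤j-i i≤j) = ℤP.0≤i⇒+∣i∣≡i (ℤP.i≤j⇒0≤j-i i≤j)

private
  head-in-range : ∀ lo n → lo < lo + + suc n
  head-in-range lo n = subst (lo <_) (i+1+d≡i+[1+d] lo n) (ℤP.<-≤-trans (i<i+1 lo) (i≤i+d _ n))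

  ≤-from-tail : ∀ {lo r} → lo + 1ℤ ≤ r → lo ≤ r
  ≤-from-tail {lo} = ℤP.≤-trans (ℤP.<⇒≤ (i<i+1 lo))

  <-from-tail : ∀ lo n {r} → r < lo + 1ℤ + + n → r < lo + + suc n
  <-from-tail lo n = subst (_ <_) (i+1+d≡i+[1+d] lo n)

sumR-+ : ∀ f lo d → sumR f lo (lo + + d) ≡ sumN f lo d
sumR-+ f lo d = cong (sumN f lo) (len-+ lo d)

sumN-+ : ∀ f lo a b → sumN f lo (a ℕ.+ b) ≡ sumN f lo a + sumN f (lo + + a) b
sumN-+ f lo zero    b rewrite ℤP.+-identityʳ lo = sym (ℤP.+-identityˡ _)
sumN-+ f lo (suc a) b rewrite sumN-+ f (lo + 1ℤ) a b | i+1+d≡i+[1+d] lo a =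
  sym (ℤP.+-assoc (f lo) _ _)

sumR-split : ∀ f {lo mid hi} → lo ≤ mid → mid ≤ hi →
             sumR f lo hi ≡ sumR f lo mid + sumR f mid hi
sumR-split f {lo} lo≤mid mid≤hi with i≤j⇒∃[d]j≡i+d lo≤mid | i≤j⇒∃[d]j≡i+d mid≤hi
... | a , refl | b , refl = begin
  sumR f lo (lo + + a + + b)                            ≡⟨ cong (sumR f lo) lo+a+b≡lo+[a+b] ⟩
  sumR f lo (lo + + (a ℕ.+ b))                          ≡⟨ sumR-+ f lo (a ℕ.+ b) ⟩
  sumN f lo (a ℕ.+ b)                                   ≡⟨ sumN-+ f lo a b ⟩
  sumN f lo a + sumN f (lo + + a) b                     ≡⟨ sym (cong₂ _+_ (sumR-+ f lo a) (sumR-+ f (lo + + a) b)) ⟩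
  sumR f lo (lo + + a) + sumR f (lo + + a) (lo + + a + + b) ∎
  where
  open ≡-Reasoning
  lo+a+b≡lo+[a+b] : lo + + a + + b ≡ lo + + (a ℕ.+ b)
  lo+a+b≡lo+[a+b] = trans (ℤP.+-assoc lo (+ a) (+ b)) (cong (_+_ lo) (sym (ℤP.pos-+ a b)))

sumN-cong : ∀ f g lo n → (∀ r → lo ≤ r → r < lo + + n → f r ≡ g r) → sumN f lo n ≡ sumN g lo n
sumN-cong f g lo zero    f≗g = refl
sumN-cong f g lo (suc n) f≗g =
  cong₂ _+_ (f≗g lo ℤP.≤-refl (head-in-range lo n))
            (sumN-cong f g (lo + 1ℤ) n (λ r p q → f≗g r (≤-from-tail p) (<-from-tail lo n q)))

sumR-cong : ∀ f g {lo hi} → lo ≤ hi → (∀ r → lo ≤ r → r < hi → f r ≡ g r) →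
            sumR f lo hi ≡ sumR g lo hi
sumR-cong f g {lo} lo≤hi f≗g with i≤j⇒∃[d]j≡i+d lo≤hi
... | d , refl = trans (sumR-+ f lo d) (trans (sumN-cong f g lo d f≗g) (sym (sumR-+ g lo d)))

sumN-const : ∀ x lo n → sumN (λ _ → x) lo n ≡ + n ℤ.* x
sumN-const x lo zero    = sym (ℤP.*-zeroˡ x)
sumN-const x lo (suc n) = begin
  x + sumN (λ _ → x) (lo + 1ℤ) n ≡⟨ cong (_+_ x) (sumN-const x (lo + 1ℤ) n) ⟩
  x + + n ℤ.* x                  ≡⟨ x+n*x≡[1+n]*x x (+ n) ⟩
  (1ℤ + + n) ℤ.* x               ≡⟨ cong (ℤ._* x) (sym (ℤP.pos-+ 1 n)) ⟩
  + suc n ℤ.* x                  ∎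
  where open ≡-Reasoning
        x+n*x≡[1+n]*x : ∀ x n → x + n ℤ.* x ≡ (1ℤ + n) ℤ.* x
        x+n*x≡[1+n]*x = solve-∀

sumR-zero : ∀ f {lo hi} → lo ≤ hi → (∀ r → lo ≤ r → r < hi → f r ≡ 0ℤ) → sumR f lo hi ≡ 0ℤ
sumR-zero f {lo} lo≤hi f≡0 with i≤j⇒∃[d]j≡i+d lo≤hi
... | d , refl = begin
  sumR f lo (lo + + d)             ≡⟨ sumR-cong f (λ _ → 0ℤ) lo≤hi f≡0 ⟩
  sumR (λ _ → 0ℤ) lo (lo + + d)    ≡⟨ sumR-+ _ lo d ⟩
  sumN (λ _ → 0ℤ) lo d             ≡⟨ sumN-const 0ℤ lo d ⟩
  + d ℤ.* 0ℤ                       ≡⟨ ℤP.*-zeroʳ (+ d) ⟩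
  0ℤ                               ∎
  where open ≡-Reasoning

sumR-one : ∀ f {lo hi} → lo ≤ hi → (∀ r → lo ≤ r → r < hi → f r ≡ 1ℤ) → sumR f lo hi ≡ hi - lo
sumR-one f {lo} lo≤hi f≡1 with i≤j⇒∃[d]j≡i+d lo≤hi
... | d , refl = begin
  sumR f lo (lo + + d)             ≡⟨ sumR-cong f (λ _ → 1ℤ) lo≤hi f≡1 ⟩
  sumR (λ _ → 1ℤ) lo (lo + + d)    ≡⟨ sumR-+ _ lo d ⟩
  sumN (λ _ → 1ℤ) lo d             ≡⟨ sumN-const 1ℤ lo d ⟩
  + d ℤ.* 1ℤ                       ≡⟨ ℤP.*-identityʳ (+ d) ⟩
  + d                              ≡⟨ sym (lo+d-lo≡d lo (+ d)) ⟩
  lo + + d - lo                    ∎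
  where open ≡-Reasoning
        lo+d-lo≡d : ∀ lo d → lo + d - lo ≡ d
        lo+d-lo≡d = solve-∀

sumR-step : ∀ f {lo t hi} → lo ≤ t → t ≤ hi →
            (∀ r → lo ≤ r → r < t → f r ≡ 1ℤ) → (∀ r → t ≤ r → r < hi → f r ≡ 0ℤ) →
            sumR f lo hi ≡ t - lo
sumR-step f {lo} {t} {hi} lo≤t t≤hi f≡1 f≡0 = begin
  sumR f lo hi                ≡⟨ sumR-split f lo≤t t≤hi ⟩
  sumR f lo t + sumR f t hi   ≡⟨ cong₂ _+_ (sumR-one f lo≤t f≡1) (sumR-zero f t≤hi f≡0) ⟩
  (t - lo) + 0ℤ               ≡⟨ ℤP.+-identityʳ _ ⟩
  t - lo                      ∎
  where open ≡-Reasoning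

sumR-single : ∀ f {lo p hi} → lo ≤ p → p < hi → f p ≡ 1ℤ →
              (∀ r → lo ≤ r → r < hi → r ≢ p → f r ≡ 0ℤ) → sumR f lo hi ≡ 1ℤ
sumR-single f {lo} {p} {hi} lo≤p p<hi fp≡1 f≡0 = begin
  sumR f lo hi                                  ≡⟨ sumR-split f lo≤p (ℤP.<⇒≤ p<hi) ⟩
  sumR f lo p + sumR f p hi                     ≡⟨ cong₂ _+_ below (sumR-step f (ℤP.<⇒≤ (i<i+1 p)) p+1≤hi at above) ⟩
  0ℤ + (p + 1ℤ - p)                             ≡⟨ ℤP.+-identityˡ _ ⟩
  p + 1ℤ - p                                    ≡⟨ p+1-p≡1 p ⟩
  1ℤ                                            ∎
  where
  open ≡-Reasoning
  p+1-p≡1 : ∀ p → p + 1ℤ - p ≡ 1ℤ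
  p+1-p≡1 = solve-∀
  p+1≤hi = i<j⇒i+1≤j p<hi
  below : sumR f lo p ≡ 0ℤ
  below = sumR-zero f lo≤p (λ r lo≤r r<p → f≡0 r lo≤r (ℤP.<-trans r<p p<hi) (ℤP.<⇒≢ r<p))
  at : ∀ r → p ≤ r → r < p + 1ℤ → f r ≡ 1ℤ
  at r p≤r r<p+1 = subst (λ x → f x ≡ 1ℤ) (ℤP.≤-antisym p≤r r≤p) fp≡1
    where r≤p = ℤP.≮⇒≥ (λ p<r → ℤP.<⇒≱ r<p+1 (i<j⇒i+1≤j p<r))
  above : ∀ r → p + 1ℤ ≤ r → r < hi → f r ≡ 0ℤ
  above r p+1≤r r<hi = f≡0 r (ℤP.≤-trans lo≤p (≤-from-tail p+1≤r)) r<hi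
    (λ r≡p → ℤP.<-irrefl (sym r≡p) (ℤP.<-≤-trans (i<i+1 p) p+1≤r))

sumN-nonneg : ∀ f lo n → (∀ r → lo ≤ r → r < lo + + n → 0ℤ ≤ f r) → 0ℤ ≤ sumN f lo n
sumN-nonneg f lo zero    f≥0 = ℤP.≤-refl
sumN-nonneg f lo (suc n) f≥0 =
  ℤP.+-mono-≤ (f≥0 lo ℤP.≤-refl (head-in-range lo n))
              (sumN-nonneg f (lo + 1ℤ) n (λ r p q → f≥0 r (≤-from-tail p) (<-from-tail lo n q)))

sumR-nonneg : ∀ f {lo hi} → lo ≤ hi → (∀ r → lo ≤ r → r < hi → 0ℤ ≤ f r) → 0ℤ ≤ sumR f lo hi
sumR-nonneg f {lo} lo≤hi f≥0 with i≤j⇒∃[d]j≡i+d lo≤hi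
... | d , refl = subst (0ℤ ≤_) (sym (sumR-+ f lo d)) (sumN-nonneg f lo d f≥0)

sumR-mono-⊆ : ∀ f {lo lo′ hi′ hi} → lo ≤ lo′ → lo′ ≤ hi′ → hi′ ≤ hi →
              (∀ r → lo ≤ r → r < hi → 0ℤ ≤ f r) → sumR f lo′ hi′ ≤ sumR f lo hi
sumR-mono-⊆ f {lo} {lo′} {hi′} {hi} lo≤lo′ lo′≤hi′ hi′≤hi f≥0 = begin
  sumR f lo′ hi′                                ≡⟨ sym (ℤP.+-identityˡ _) ⟩
  0ℤ + sumR f lo′ hi′                           ≤⟨ ℤP.+-monoˡ-≤ (sumR f lo′ hi′) prefix≥0 ⟩
  sumR f lo lo′ + sumR f lo′ hi′                ≡⟨ sym (ℤP.+-identityʳ _) ⟩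
  sumR f lo lo′ + sumR f lo′ hi′ + 0ℤ           ≤⟨ ℤP.+-monoʳ-≤ (sumR f lo lo′ + sumR f lo′ hi′) suffix≥0 ⟩
  sumR f lo lo′ + sumR f lo′ hi′ + sumR f hi′ hi ≡⟨ sym (trans (sumR-split f lo≤lo′ lo′≤hi)
                                                      (trans (cong (_+_ (sumR f lo lo′)) (sumR-split f lo′≤hi′ hi′≤hi))
                                                             (sym (ℤP.+-assoc (sumR f lo lo′) _ _)))) ⟩
  sumR f lo hi                                  ∎
  where
  open ℤP.≤-Reasoning
  lo′≤hi = ℤP.≤-trans lo′≤hi′ hi′≤hi
  prefix≥0 = sumR-nonneg f lo≤lo′ (λ r p q → f≥0 r p (ℤP.<-≤-trans q lo′≤hi))
  suffix≥0 = sumR-nonneg f hi′≤hi (λ r p q → f≥0 r (ℤP.≤-trans (ℤP.≤-trans lo≤lo′ lo′≤hi′) p) q)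

minN-≤ : ∀ f lo n t → t ℕ.≤ n → minN f lo n ≤ f (lo + + t)
minN-≤ f lo zero    .zero z≤n rewrite ℤP.+-identityʳ lo = ℤP.≤-refl
minN-≤ f lo (suc n) zero  z≤n rewrite ℤP.+-identityʳ lo = ℤP.i⊓j≤i (f lo) _
minN-≤ f lo (suc n) (suc t) (s≤s t≤n) =
  ℤP.≤-trans (ℤP.i⊓j≤j (f lo) _)
    (subst (λ x → minN f (lo + 1ℤ) n ≤ f x) (i+1+d≡i+[1+d] lo t) (minN-≤ f (lo + 1ℤ) n t t≤n))

minN-attained : ∀ f lo n → ∃[ t ] t ℕ.≤ n × minN f lo n ≡ f (lo + + t)
minN-attained f lo zero = 0 , z≤n , sym (cong f (ℤP.+-identityʳ lo))
minN-attained f lo (suc n) with ℤP.≤-total (f lo) (minN f (lo + 1ℤ) n)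
... | inj₁ here≤ = 0 , z≤n , trans (ℤP.i≤j⇒i⊓j≡i here≤) (sym (cong f (ℤP.+-identityʳ lo)))
... | inj₂ rest≤ with minN-attained f (lo + 1ℤ) n
...   | t , t≤n , eq = suc t , s≤s t≤n ,
                        trans (ℤP.i≥j⇒i⊓j≡j rest≤) (trans eq (cong f (i+1+d≡i+[1+d] lo t)))

attained-lower-bound⇒minR≡ : ∀ f {lo hi} v → lo ≤ hi → (∀ j → lo ≤ j → j ≤ hi → v ≤ f j) →
                             (∃[ j ] lo ≤ j × j ≤ hi × f j ≡ v) → minR f lo hi ≡ v
attained-lower-bound⇒minR≡ f {lo} v lo≤hi v≤f (j , lo≤j , j≤hi , fj≡v)
  with i≤j⇒∃[d]j≡i+d lo≤hi | i≤j⇒∃[d]j≡i+d lo≤j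
... | d , refl | t , refl rewrite len-+ lo d with minN-attained f lo d
...   | t′ , t′≤d , eq = ℤP.≤-antisym
  (subst (minN f lo d ≤_) fj≡v (minN-≤ f lo d t t≤d))
  (subst (v ≤_) (sym eq) (v≤f (lo + + t′) (i≤i+d lo t′) (ℤP.+-monoʳ-≤ lo (+≤+ t′≤d))))
  where t≤d = ℤP.drop‿+≤+ (+-cancelˡ-≤ lo j≤hi)

-- Common subsequences

++-cancel-length : ∀ {B : Set} (xs xs′ : List B) {ys ys′} → length xs ≡ length xs′ →
                   xs ++ ys ≡ xs′ ++ ys′ → xs ≡ xs′ × ys ≡ ys′
++-cancel-length []       []         _   eq = refl , eq
++-cancel-length (x ∷ xs) (x′ ∷ xs′) len≡ eq with ListP.∷-injective eq
... | refl , eq′ with ++-cancel-length xs xs′ (ℕP.suc-injective len≡) eq′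
...   | refl , ys≡ys′ = refl , ys≡ys′

module _ {A : Set} where

  commonSub-≤-lengthˡ : ∀ {u : List A} {v k} → CommonSub u v k → k ℕ.≤ length u
  commonSub-≤-lengthˡ done       = z≤n
  commonSub-≤-lengthˡ (skipL d)  = ℕP.m≤n⇒m≤1+n (commonSub-≤-lengthˡ d)
  commonSub-≤-lengthˡ (skipR d)  = commonSub-≤-lengthˡ d
  commonSub-≤-lengthˡ (take _ d) = s≤s (commonSub-≤-lengthˡ d)

  commonSub-≤-lengthʳ : ∀ {u : List A} {v k} → CommonSub u v k → k ℕ.≤ length v
  commonSub-≤-lengthʳ done       = z≤n
  commonSub-≤-lengthʳ (skipL d)  = commonSub-≤-lengthʳ d
  commonSub-≤-lengthʳ (skipR d)  = ℕP.m≤n⇒m≤1+n (commonSub-≤-lengthʳ d)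
  commonSub-≤-lengthʳ (take _ d) = s≤s (commonSub-≤-lengthʳ d)

  commonSub-[]ʳ : ∀ (u : List A) → CommonSub u [] 0
  commonSub-[]ʳ []      = done
  commonSub-[]ʳ (_ ∷ u) = skipL (commonSub-[]ʳ u)

  commonSub-[]ˡ : ∀ (v : List (Maybe A)) → CommonSub [] v 0
  commonSub-[]ˡ []      = done
  commonSub-[]ˡ (_ ∷ v) = skipR (commonSub-[]ˡ v)

  commonSub-++ : ∀ {u₁ u₂ : List A} {v₁ v₂ k₁ k₂} → CommonSub u₁ v₁ k₁ → CommonSub u₂ v₂ k₂ →
                 CommonSub (u₁ ++ u₂) (v₁ ++ v₂) (k₁ ℕ.+ k₂)
  commonSub-++ done       e = e
  commonSub-++ (skipL d)  e = skipL (commonSub-++ d e)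
  commonSub-++ (skipR d)  e = skipR (commonSub-++ d e)
  commonSub-++ (take m d) e = take m (commonSub-++ d e)

  commonSub-++⁻ : ∀ (u₁ : List A) {u₂ v k} → CommonSub (u₁ ++ u₂) v k →
                  ∃[ v₁ ] ∃[ v₂ ] ∃[ k₁ ] ∃[ k₂ ] v ≡ v₁ ++ v₂ × k ≡ k₁ ℕ.+ k₂ ×
                                                  CommonSub u₁ v₁ k₁ × CommonSub u₂ v₂ k₂
  commonSub-++⁻ []        d = [] , _ , 0 , _ , refl , refl , done , d
  commonSub-++⁻ (_ ∷ u₁) (skipL d) with commonSub-++⁻ u₁ d
  ... | v₁ , v₂ , k₁ , k₂ , refl , refl , d₁ , d₂ = v₁ , v₂ , k₁ , k₂ , refl , refl , skipL d₁ , d₂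
  commonSub-++⁻ (a ∷ u₁) (skipR {c} d) with commonSub-++⁻ (a ∷ u₁) d
  ... | v₁ , v₂ , k₁ , k₂ , refl , refl , d₁ , d₂ = c ∷ v₁ , v₂ , k₁ , k₂ , refl , refl , skipR d₁ , d₂
  commonSub-++⁻ (_ ∷ u₁) (take {c = c} m d) with commonSub-++⁻ u₁ d
  ... | v₁ , v₂ , k₁ , k₂ , refl , refl , d₁ , d₂ = c ∷ v₁ , v₂ , suc k₁ , k₂ , refl , refl , take m d₁ , d₂

  commonSub-restrict-suffix : ∀ (v₁ : List (Maybe A)) {u v₂ k} → CommonSub u (v₁ ++ v₂) k →
                              ∃[ k′ ] CommonSub u v₂ k′ × k ℕ.≤ length v₁ ℕ.+ k′
  commonSub-restrict-suffix []       d = _ , d , ℕP.≤-refl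
  commonSub-restrict-suffix (c ∷ v₁) (skipL d) with commonSub-restrict-suffix (c ∷ v₁) d
  ... | k′ , e , k≤ = k′ , skipL e , k≤
  commonSub-restrict-suffix (c ∷ v₁) (skipR d) with commonSub-restrict-suffix v₁ d
  ... | k′ , e , k≤ = k′ , e , ℕP.m≤n⇒m≤1+n k≤
  commonSub-restrict-suffix (c ∷ v₁) (take _ d) with commonSub-restrict-suffix v₁ d
  ... | k′ , e , k≤ = k′ , skipL e , s≤s k≤

  commonSub-restrict-prefix : ∀ (v₁ : List (Maybe A)) {u v₂ k} → CommonSub u (v₁ ++ v₂) k →
                              ∃[ k′ ] CommonSub u v₁ k′ × k ℕ.≤ k′ ℕ.+ length v₂
  commonSub-restrict-prefix []       {u} d = 0 , commonSub-[]ʳ u , commonSub-≤-lengthʳ d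
  commonSub-restrict-prefix (c ∷ v₁) (skipL d) with commonSub-restrict-prefix (c ∷ v₁) d
  ... | k′ , e , k≤ = k′ , skipL e , k≤
  commonSub-restrict-prefix (c ∷ v₁) (skipR d) with commonSub-restrict-prefix v₁ d
  ... | k′ , e , k≤ = k′ , skipR e , k≤
  commonSub-restrict-prefix (c ∷ v₁) (take m d) with commonSub-restrict-prefix v₁ d
  ... | k′ , e , k≤ = suc k′ , take m e , s≤s k≤

  commonSub-wildcards : ∀ L (u : List A) → CommonSub u (replicate L nothing) (L ℕ.⊓ length u)
  commonSub-wildcards zero    u       = commonSub-[]ʳ u
  commonSub-wildcards (suc L) []      = commonSub-[]ˡ _
  commonSub-wildcards (suc L) (_ ∷ u) = take tt (commonSub-wildcards L u)

  isLCS-full : ∀ {u : List A} {v} → CommonSub u v (length u) → IsLCS u v (length u)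
  isLCS-full d = d , λ _ → commonSub-≤-lengthˡ

  isLCS-wildcards : ∀ L (u : List A) → IsLCS u (replicate L nothing) (L ℕ.⊓ length u)
  isLCS-wildcards L u = commonSub-wildcards L u , λ _ d →
    ℕP.⊓-glb (subst (_ ℕ.≤_) (ListP.length-replicate L) (commonSub-≤-lengthʳ d)) (commonSub-≤-lengthˡ d)

-- Windows c⟨i:j⟩ of the padded string c = ◇^p y ◇^p

Wildcards : {A : Set} → List A → ℤ → ℤ → Set
Wildcards y i j = ∀ r → i ≤ r → r < j → cAt y r ≡ nothing

module _ {A : Set} where

  private
    window : List A → ℤ → ℕ → List (Maybe A)
    window y i n = map (cAt y) (rangeL i n)

    window-++ : ∀ y i a b → window y i (a ℕ.+ b) ≡ window y i a ++ window y (i + + a) b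
    window-++ y i zero    b = cong (λ x → window y x b) (sym (ℤP.+-identityʳ i))
    window-++ y i (suc a) b = cong (cAt y i ∷_)
      (trans (window-++ y (i + 1ℤ) a b) (cong (λ x → window y (i + 1ℤ) a ++ window y x b) (i+1+d≡i+[1+d] i a)))

    window-wild : ∀ y i n → (∀ r → i ≤ r → r < i + + n → cAt y r ≡ nothing) →
                  window y i n ≡ replicate n nothing
    window-wild y i zero    _    = refl
    window-wild y i (suc n) wild = cong₂ _∷_ (wild i ℤP.≤-refl (head-in-range i n))
      (window-wild y (i + 1ℤ) n (λ r p q → wild r (≤-from-tail p) (<-from-tail i n q)))

    length-rangeL : ∀ i n → length (rangeL i n) ≡ n
    length-rangeL i zero    = refl
    length-rangeL i (suc n) = cong suc (length-rangeL (i + 1ℤ) n)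

  length-subC : ∀ (y : List A) i j → length (subC y i j) ≡ len i j
  length-subC y i j = trans (ListP.length-map (cAt y) (rangeL i (len i j))) (length-rangeL i (len i j))

  subC-++ : ∀ (y : List A) {i j k} → i ≤ j → j ≤ k → subC y i k ≡ subC y i j ++ subC y j k
  subC-++ y {i} i≤j j≤k with i≤j⇒∃[d]j≡i+d i≤j | i≤j⇒∃[d]j≡i+d j≤k
  ... | a , refl | b , refl = begin
    subC y i (i + + a + + b)                 ≡⟨ cong (subC y i) i+a+b≡i+[a+b] ⟩
    window y i (len i (i + + (a ℕ.+ b)))     ≡⟨ cong (window y i) (len-+ i (a ℕ.+ b)) ⟩
    window y i (a ℕ.+ b)                     ≡⟨ window-++ y i a b ⟩
    window y i a ++ window y (i + + a) b     ≡⟨ sym (cong₂ (λ m n → window y i m ++ window y (i + + a) n)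
                                                           (len-+ i a) (len-+ (i + + a) b)) ⟩
    subC y i (i + + a) ++ subC y (i + + a) (i + + a + + b) ∎
    where
    open ≡-Reasoning
    i+a+b≡i+[a+b] : i + + a + + b ≡ i + + (a ℕ.+ b)
    i+a+b≡i+[a+b] = trans (ℤP.+-assoc i (+ a) (+ b)) (cong (_+_ i) (sym (ℤP.pos-+ a b)))

  subC-wild : ∀ (y : List A) {i j} → i ≤ j → Wildcards y i j → subC y i j ≡ replicate (len i j) nothing
  subC-wild y {i} i≤j wild with i≤j⇒∃[d]j≡i+d i≤j
  ... | d , refl rewrite len-+ i d = window-wild y i d wild

  wildcards-left : ∀ (y : List A) {i j} → j ≤ 0ℤ → Wildcards y i j
  wildcards-left y j≤0 -[1+ n ] _ _   = refl
  wildcards-left y j≤0 (+ n)   _ r<j = ⊥-elim (ℤP.<⇒≱ (ℤP.<-≤-trans r<j j≤0) (+≤+ z≤n))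

  wildcards-right : ∀ (y : List A) {i j} → + length y ≤ i → Wildcards y i j
  wildcards-right y y≤i r i≤r _ with ℤP.≤-trans y≤i i≤r
  ... | +≤+ y≤n = nth-beyond y y≤n
    where
    nth-beyond : ∀ (y : List A) {n} → length y ℕ.≤ n → nth y n ≡ nothing
    nth-beyond []      _         = refl
    nth-beyond (_ ∷ y) (s≤s y≤n) = nth-beyond y y≤n

  commonSub≤width : ∀ {u : List A} {y i j c} → i ≤ j → CommonSub u (subC y i j) c → + c ≤ j - i
  commonSub≤width {y = y} {i} {j} i≤j d =
    subst (_ ≤_) (+len i≤j) (+≤+ (subst (_ ℕ.≤_) (length-subC y i j) (commonSub-≤-lengthʳ d)))

  commonSub-window-++⁻ : ∀ (u w y : List A) {i k c} → i ≤ k → CommonSub (u ++ w) (subC y i k) c →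
    ∃[ j ] i ≤ j × j ≤ k × ∃[ c₁ ] ∃[ c₂ ] c ≡ c₁ ℕ.+ c₂ ×
           CommonSub u (subC y i j) c₁ × CommonSub w (subC y j k) c₂
  commonSub-window-++⁻ u w y {i} {k} i≤k d with commonSub-++⁻ u d
  ... | v₁ , v₂ , c₁ , c₂ , v≡ , c≡ , d₁ , d₂ =
    j , i≤j , j≤k , c₁ , c₂ , c≡ ,
    subst (λ v → CommonSub u v c₁) (proj₁ pieces) d₁ , subst (λ v → CommonSub w v c₂) (proj₂ pieces) d₂
    where
    j = i + + length v₁
    i≤j = i≤i+d i (length v₁)
    j≤k : j ≤ k
    j≤k = subst (j ≤_) (trans (cong (_+_ i) (+len i≤k)) (i+[k-i]≡k i k))
            (ℤP.+-monoʳ-≤ i (+≤+ (subst (length v₁ ℕ.≤_) len-v (ℕP.m≤m+n (length v₁) (length v₂)))))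
      where
      len-v : length v₁ ℕ.+ length v₂ ≡ len i k
      len-v = trans (sym (ListP.length-++ v₁)) (trans (cong length (sym v≡)) (length-subC y i k))
      i+[k-i]≡k : ∀ i k → i + (k - i) ≡ k
      i+[k-i]≡k = solve-∀
    pieces : v₁ ≡ subC y i j × v₂ ≡ subC y j k
    pieces = ++-cancel-length v₁ (subC y i j) (sym (trans (length-subC y i j) (len-+ i (length v₁))))
                              (trans (sym v≡) (subC-++ y i≤j j≤k))

module _ {A : Set} {x y : List A} where

  score-lcs : ∀ {i j h} → i ≤ j → HScore x y i j h → ∃[ c ] IsLCS x (subC y i j) c × h ≡ + c
  score-lcs i≤j (inj₁ (_ , c , lcs , h≡)) = c , lcs , h≡
  score-lcs i≤j (inj₂ (j<i , _))          = ⊥-elim (ℤP.<⇒≱ j<i i≤j)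

  score-reversed : ∀ {i j h} → j < i → HScore x y i j h → h ≡ j - i
  score-reversed j<i (inj₁ (i≤j , _)) = ⊥-elim (ℤP.<⇒≱ j<i i≤j)
  score-reversed j<i (inj₂ (_ , h≡))  = h≡

  commonSub≤score : ∀ {i j h c} → i ≤ j → HScore x y i j h → CommonSub x (subC y i j) c → + c ≤ h
  commonSub≤score i≤j H d with score-lcs i≤j H
  ... | _ , (_ , maximal) , refl = +≤+ (maximal _ d)

  score-nonneg : ∀ {i j h} → i ≤ j → HScore x y i j h → 0ℤ ≤ h
  score-nonneg i≤j H with score-lcs i≤j H
  ... | _ , _ , refl = 0≤+d _

  score-≤-width : ∀ {i j h} → HScore x y i j h → h ≤ j - i
  score-≤-width (inj₁ (i≤j , c , (d , _) , refl)) = commonSub≤width i≤j d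
  score-≤-width (inj₂ (_ , refl))                 = ℤP.≤-refl

  score-unique : ∀ {i j h h′} → HScore x y i j h → HScore x y i j h′ → h ≡ h′
  score-unique (inj₁ (i≤j , c , lcs , refl)) H′ with score-lcs i≤j H′
  ... | c′ , lcs′ , refl = cong +_ (ℕP.≤-antisym (proj₂ lcs′ c (proj₁ lcs)) (proj₂ lcs c′ (proj₁ lcs′)))
  score-unique (inj₂ (j<i , refl)) H′ = sym (score-reversed j<i H′)

  score-wildcards : ∀ {i j} → Wildcards y i j → HScore x y i j ((j - i) ⊓ + length x)
  score-wildcards {i} {j} wild with i ℤP.≤? j
  ... | yes i≤j = inj₁ (i≤j , len i j ℕ.⊓ length x ,
                        subst (λ v → IsLCS x v (len i j ℕ.⊓ length x)) (sym (subC-wild y i≤j wild))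
                              (isLCS-wildcards (len i j) x) ,
                        cong (_⊓ + length x) (sym (+len i≤j)))
  ... | no i≰j = inj₂ (j<i , ℤP.i≤j⇒i⊓j≡i (ℤP.≤-trans (ℤP.i≤j⇒i-j≤0 (ℤP.<⇒≤ j<i)) (0≤+d _)))
    where j<i = ℤP.≰⇒> i≰j

  score-full : ∀ {i s t j} → i ≤ s → s ≤ t → t ≤ j → Wildcards y s t → + length x ≤ t - s →
               HScore x y i j (+ length x)
  score-full {i} {s} {t} {j} i≤s s≤t t≤j wild x≤t-s =
    inj₁ (i≤j , length x , isLCS-full (subst (λ v → CommonSub x v (length x)) (sym window≡) padded) , refl)
    where
    i≤j = ℤP.≤-trans i≤s (ℤP.≤-trans s≤t t≤j)
    window≡ : subC y i j ≡ subC y i s ++ (subC y s t ++ subC y t j)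
    window≡ = trans (subC-++ y i≤s (ℤP.≤-trans s≤t t≤j)) (cong (subC y i s ++_) (subC-++ y s≤t t≤j))
    x≤len = ℤP.drop‿+≤+ (subst (_ ≤_) (sym (+len s≤t)) x≤t-s)
    middle : CommonSub x (subC y s t) (length x)
    middle = subst₂ (CommonSub x) (sym (subC-wild y s≤t wild)) (ℕP.m≥n⇒m⊓n≡n x≤len)
                    (commonSub-wildcards (len s t) x)
    padded : CommonSub x (subC y i s ++ (subC y s t ++ subC y t j)) (length x)
    padded = commonSub-++ (commonSub-[]ˡ (subC y i s))
               (subst₂ (λ v n → CommonSub v _ n) (ListP.++-identityʳ x) (ℕP.+-identityʳ _)
                 (commonSub-++ middle (commonSub-[]ˡ (subC y t j))))

-- Scores of a concatenation

private
  +c≤width+c′ : ∀ {A : Set} (y : List A) {i j} {c c′ : ℕ} → i ≤ j →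
                c ℕ.≤ length (subC y i j) ℕ.+ c′ → + c ≤ (j - i) + + c′
  +c≤width+c′ y {i} {j} {c} {c′} i≤j c≤ =
    subst (+ c ≤_) (trans (ℤP.pos-+ (len i j) c′) (cong (_+ + c′) (+len i≤j)))
          (+≤+ (subst (λ n → c ℕ.≤ n ℕ.+ c′) (length-subC y i j) c≤))

  +c≤c′+width : ∀ {A : Set} (y : List A) {i j} {c c′ : ℕ} → i ≤ j →
                c ℕ.≤ c′ ℕ.+ length (subC y i j) → + c ≤ + c′ + (j - i)
  +c≤c′+width y {i} {j} {c} {c′} i≤j c≤ =
    subst (+ c ≤_) (trans (ℤP.pos-+ c′ (len i j)) (cong (_+_ (+ c′)) (+len i≤j)))
          (+≤+ (subst (λ n → c ℕ.≤ c′ ℕ.+ n) (length-subC y i j) c≤))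

module _ {A : Set} (u w y : List A) {i j k hA hB hC : ℤ}
         (HA : HScore u y i j hA) (HB : HScore w y j k hB) (HC : HScore (u ++ w) y i k hC) where

  private
    open ℤP.≤-Reasoning

    sum≤score-reversed : k < i → hA + hB ≤ hC
    sum≤score-reversed k<i = begin
      hA + hB           ≤⟨ ℤP.+-mono-≤ (score-≤-width HA) (score-≤-width HB) ⟩
      (j - i) + (k - j) ≡⟨ [j-i]+[k-j]≡k-i i j k ⟩
      k - i             ≡⟨ sym (score-reversed k<i HC) ⟩
      hC                ∎
      where [j-i]+[k-j]≡k-i : ∀ i j k → (j - i) + (k - j) ≡ k - i
            [j-i]+[k-j]≡k-i = solve-∀

    sum≤score-inside : i ≤ j → j ≤ k → hA + hB ≤ hC
    sum≤score-inside i≤j j≤k with score-lcs i≤j HA | score-lcs j≤k HB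
    ... | cA , (dA , _) , refl | cB , (dB , _) , refl =
      subst (_≤ hC) (ℤP.pos-+ cA cB)
        (commonSub≤score (ℤP.≤-trans i≤j j≤k) HC
          (subst (λ v → CommonSub (u ++ w) v (cA ℕ.+ cB)) (sym (subC-++ y i≤j j≤k)) (commonSub-++ dA dB)))

    sum≤score-before : j < i → i ≤ k → hA + hB ≤ hC
    sum≤score-before j<i i≤k with score-lcs (ℤP.<⇒≤ (ℤP.<-≤-trans j<i i≤k)) HB
    ... | cB , (dB , _) , refl with commonSub-restrict-suffix (subC y j i)
                                      (subst (λ v → CommonSub w v cB) (subC-++ y (ℤP.<⇒≤ j<i) i≤k) dB)
    ...   | c′ , d′ , cB≤ = begin
      hA + + cB                  ≤⟨ ℤP.+-mono-≤ (ℤP.≤-reflexive (score-reversed j<i HA))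
                                      (+c≤width+c′ y (ℤP.<⇒≤ j<i) cB≤) ⟩
      (j - i) + ((i - j) + + c′) ≡⟨ [j-i]+[[i-j]+c]≡c i j (+ c′) ⟩
      + c′                       ≤⟨ commonSub≤score i≤k HC (commonSub-++ (commonSub-[]ʳ u) d′) ⟩
      hC                         ∎
      where [j-i]+[[i-j]+c]≡c : ∀ i j c → (j - i) + ((i - j) + c) ≡ c
            [j-i]+[[i-j]+c]≡c = solve-∀

    sum≤score-after : i ≤ k → k < j → hA + hB ≤ hC
    sum≤score-after i≤k k<j with score-lcs (ℤP.≤-trans i≤k (ℤP.<⇒≤ k<j)) HA
    ... | cA , (dA , _) , refl with commonSub-restrict-prefix (subC y i k)
                                      (subst (λ v → CommonSub u v cA) (subC-++ y i≤k (ℤP.<⇒≤ k<j)) dA)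
    ...   | c′ , d′ , cA≤ = begin
      + cA + hB                  ≤⟨ ℤP.+-mono-≤
                                      (+c≤c′+width y (ℤP.<⇒≤ k<j) cA≤)
                                      (ℤP.≤-reflexive (score-reversed k<j HB)) ⟩
      (+ c′ + (j - k)) + (k - j) ≡⟨ [c+[j-k]]+[k-j]≡c j k (+ c′) ⟩
      + c′                       ≤⟨ commonSub≤score i≤k HC d″ ⟩
      hC                         ∎
      where [c+[j-k]]+[k-j]≡c : ∀ j k c → (c + (j - k)) + (k - j) ≡ c
            [c+[j-k]]+[k-j]≡c = solve-∀
            d″ : CommonSub (u ++ w) (subC y i k) c′
            d″ = subst₂ (CommonSub (u ++ w)) (ListP.++-identityʳ _) (ℕP.+-identityʳ c′)
                        (commonSub-++ d′ (commonSub-[]ʳ w))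

  score-++-≥-sum : hA + hB ≤ hC
  score-++-≥-sum with i ℤP.≤? k | j ℤP.<? i | k ℤP.<? j
  ... | no i≰k  | _       | _       = sum≤score-reversed (ℤP.≰⇒> i≰k)
  ... | yes i≤k | yes j<i | _       = sum≤score-before j<i i≤k
  ... | yes i≤k | no j≮i  | yes k<j = sum≤score-after i≤k k<j
  ... | yes i≤k | no j≮i  | no k≮j  = sum≤score-inside (ℤP.≮⇒≥ j≮i) (ℤP.≮⇒≥ k≮j)

module _ {A : Set} (u w y : List A) {i k J₀ J₁ hC : ℤ} (hA hB : ℤ → ℤ)
         (HA : ∀ j → J₀ ≤ j → j ≤ J₁ → HScore u y i j (hA j))
         (HB : ∀ j → J₀ ≤ j → j ≤ J₁ → HScore w y j k (hB j))
         (HC : HScore (u ++ w) y i k hC)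
         (J₀≤J₁ : J₀ ≤ J₁) (J₀≤k : J₀ ≤ k) (i≤J₁ : i ≤ J₁) where

  private
    open ℤP.≤-Reasoning

    Attained : Set
    Attained = ∃[ j ] J₀ ≤ j × j ≤ J₁ × hC ≤ hA j + hB j

    attained-reversed : k < i → Attained
    attained-reversed k<i = k , J₀≤k , k≤J₁ , (begin
      hC           ≡⟨ score-reversed k<i HC ⟩
      k - i        ≡⟨ sym (score-reversed k<i (HA k J₀≤k k≤J₁)) ⟩
      hA k         ≡⟨ sym (ℤP.+-identityʳ (hA k)) ⟩
      hA k + 0ℤ    ≤⟨ ℤP.+-monoʳ-≤ (hA k) (score-nonneg ℤP.≤-refl (HB k J₀≤k k≤J₁)) ⟩
      hA k + hB k  ∎)
      where k≤J₁ = ℤP.≤-trans (ℤP.<⇒≤ k<i) i≤J₁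

    module _ {j c₁ c₂} (i≤j : i ≤ j) (j≤k : j ≤ k) (hC≡ : hC ≡ + c₁ + + c₂)
             (d₁ : CommonSub u (subC y i j) c₁) (d₂ : CommonSub w (subC y j k) c₂) where

      attained-inside : J₀ ≤ j → j ≤ J₁ → Attained
      attained-inside J₀≤j j≤J₁ = j , J₀≤j , j≤J₁ ,
        subst (_≤ _) (sym hC≡) (ℤP.+-mono-≤ (commonSub≤score i≤j (HA j J₀≤j j≤J₁) d₁)
                                            (commonSub≤score j≤k (HB j J₀≤j j≤J₁) d₂))

      attained-before : Wildcards y i J₀ → J₀ - i ≤ + length u → j < J₀ → Attained
      attained-before wild J₀-i≤u j<J₀ with commonSub-restrict-suffix (subC y j J₀)
                                              (subst (λ v → CommonSub w v c₂) (subC-++ y (ℤP.<⇒≤ j<J₀) J₀≤k) d₂)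
      ... | c′ , d′ , c₂≤ = J₀ , ℤP.≤-refl , J₀≤J₁ , (begin
        hC                          ≡⟨ hC≡ ⟩
        + c₁ + + c₂                 ≤⟨ ℤP.+-mono-≤ (commonSub≤width i≤j d₁)
                                         (+c≤width+c′ y (ℤP.<⇒≤ j<J₀) c₂≤) ⟩
        (j - i) + ((J₀ - j) + + c′) ≡⟨ [j-i]+[[J-j]+c]≡[J-i]+c i j J₀ (+ c′) ⟩
        (J₀ - i) + + c′             ≤⟨ ℤP.+-mono-≤ (ℤP.≤-reflexive (sym hA≡))
                                                       (commonSub≤score J₀≤k (HB J₀ ℤP.≤-refl J₀≤J₁) d′) ⟩
        hA J₀ + hB J₀               ∎)
        where
        [j-i]+[[J-j]+c]≡[J-i]+c : ∀ i j J c → (j - i) + ((J - j) + c) ≡ (J - i) + c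
        [j-i]+[[J-j]+c]≡[J-i]+c = solve-∀
        hA≡ : hA J₀ ≡ J₀ - i
        hA≡ = trans (score-unique (HA J₀ ℤP.≤-refl J₀≤J₁) (score-wildcards wild)) (ℤP.i≤j⇒i⊓j≡i J₀-i≤u)

      attained-after : Wildcards y J₁ k → k - J₁ ≤ + length w → J₁ < j → Attained
      attained-after wild k-J₁≤w J₁<j with commonSub-restrict-prefix (subC y i J₁)
                                            (subst (λ v → CommonSub u v c₁) (subC-++ y i≤J₁ (ℤP.<⇒≤ J₁<j)) d₁)
      ... | c′ , d′ , c₁≤ = J₁ , J₀≤J₁ , ℤP.≤-refl , (begin
        hC                          ≡⟨ hC≡ ⟩
        + c₁ + + c₂                 ≤⟨ ℤP.+-mono-≤
                                         (+c≤c′+width y (ℤP.<⇒≤ J₁<j) c₁≤)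
                                         (commonSub≤width j≤k d₂) ⟩
        (+ c′ + (j - J₁)) + (k - j) ≡⟨ [c+[j-J]]+[k-j]≡c+[k-J] J₁ j k (+ c′) ⟩
        + c′ + (k - J₁)             ≤⟨ ℤP.+-mono-≤ (commonSub≤score i≤J₁ (HA J₁ J₀≤J₁ ℤP.≤-refl) d′)
                                                       (ℤP.≤-reflexive (sym hB≡)) ⟩
        hA J₁ + hB J₁               ∎)
        where
        [c+[j-J]]+[k-j]≡c+[k-J] : ∀ J j k c → (c + (j - J)) + (k - j) ≡ c + (k - J)
        [c+[j-J]]+[k-j]≡c+[k-J] = solve-∀
        hB≡ : hB J₁ ≡ k - J₁
        hB≡ = trans (score-unique (HB J₁ J₀≤J₁ ℤP.≤-refl) (score-wildcards wild)) (ℤP.i≤j⇒i⊓j≡i k-J₁≤w)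

  score-++-attained : (i < J₀ → Wildcards y i J₀ × J₀ - i ≤ + length u) →
                      (J₁ < k → Wildcards y J₁ k × k - J₁ ≤ + length w) →
                      ∃[ j ] J₀ ≤ j × j ≤ J₁ × hC ≤ hA j + hB j
  score-++-attained padˡ padʳ with i ℤP.≤? k
  ... | no i≰k = attained-reversed (ℤP.≰⇒> i≰k)
  ... | yes i≤k with score-lcs i≤k HC
  ...   | c , (d , _) , refl with commonSub-window-++⁻ u w y i≤k d
  ...     | j , i≤j , j≤k , c₁ , c₂ , refl , d₁ , d₂ with J₀ ℤP.≤? j | j ℤP.≤? J₁
  ...       | yes J₀≤j | yes j≤J₁ = attained-inside i≤j j≤k (ℤP.pos-+ c₁ c₂) d₁ d₂ J₀≤j j≤J₁
  ...       | no J₀≰j  | _        = attained-before i≤j j≤k (ℤP.pos-+ c₁ c₂) d₁ d₂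
                                      (proj₁ (padˡ i<J₀)) (proj₂ (padˡ i<J₀)) j<J₀
    where j<J₀ = ℤP.≰⇒> J₀≰j
          i<J₀ = ℤP.≤-<-trans i≤j j<J₀
  ...       | yes _    | no j≰J₁  = attained-after i≤j j≤k (ℤP.pos-+ c₁ c₂) d₁ d₂
                                      (proj₁ (padʳ J₁<k)) (proj₂ (padʳ J₁<k)) J₁<j
    where J₁<j = ℤP.≰⇒> j≰J₁
          J₁<k = ℤP.<-≤-trans J₁<j j≤k

-- j only ranges over [J₀, J₁]: the padding hypotheses let an optimal split point outside this range
-- be moved to its nearest end, the wildcards in between absorbing u (resp. w) completely.
minR-deficit-++ : ∀ {A : Set} (u w y : List A) {i k J₀ J₁} (DA DB : ℤ → ℤ) (DC : ℤ) →
  (∀ j → J₀ ≤ j → j ≤ J₁ → HScore u y i j (j - i - DA j)) →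
  (∀ j → J₀ ≤ j → j ≤ J₁ → HScore w y j k (k - j - DB j)) →
  HScore (u ++ w) y i k (k - i - DC) →
  J₀ ≤ J₁ → J₀ ≤ k → i ≤ J₁ →
  (i < J₀ → Wildcards y i J₀ × J₀ - i ≤ + length u) →
  (J₁ < k → Wildcards y J₁ k × k - J₁ ≤ + length w) →
  minR (λ j → DA j + DB j) J₀ J₁ ≡ DC
minR-deficit-++ u w y {i} {k} {J₀} {J₁} DA DB DC HA HB HC J₀≤J₁ J₀≤k i≤J₁ padˡ padʳ =
  attained-lower-bound⇒minR≡ _ DC J₀≤J₁ lower-bound attained
  where
  scores≡ : ∀ j → (j - i - DA j) + (k - j - DB j) ≡ (k - i) - (DA j + DB j)
  scores≡ j = [j-i-a]+[k-j-b]≡[k-i]-[a+b] i j k (DA j) (DB j)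
    where [j-i-a]+[k-j-b]≡[k-i]-[a+b] : ∀ i j k a b → (j - i - a) + (k - j - b) ≡ (k - i) - (a + b)
          [j-i-a]+[k-j-b]≡[k-i]-[a+b] = solve-∀
  -‿cancelˡ-≤ : ∀ n {a b} → n - a ≤ n - b → b ≤ a
  -‿cancelˡ-≤ n n-a≤n-b = ℤP.neg-cancel-≤ (+-cancelˡ-≤ n n-a≤n-b)
  lower-bound : ∀ j → J₀ ≤ j → j ≤ J₁ → DC ≤ DA j + DB j
  lower-bound j J₀≤j j≤J₁ = -‿cancelˡ-≤ (k - i)
    (subst (_≤ _) (scores≡ j) (score-++-≥-sum u w y (HA j J₀≤j j≤J₁) (HB j J₀≤j j≤J₁) HC))
  attained : ∃[ j ] J₀ ≤ j × j ≤ J₁ × DA j + DB j ≡ DC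
  attained with score-++-attained u w y (λ j → j - i - DA j) (λ j → k - j - DB j) HA HB HC
                                  J₀≤J₁ J₀≤k i≤J₁ padˡ padʳ
  ... | j , J₀≤j , j≤J₁ , hC≤ = j , J₀≤j , j≤J₁ ,
    ℤP.≤-antisym (-‿cancelˡ-≤ (k - i) (subst (_ ≤_) (scores≡ j) hC≤)) (lower-bound j J₀≤j j≤J₁)

private
  if-true : ∀ {b} {x y : ℤ} → b ≡ true → (if b then x else y) ≡ x
  if-true refl = refl

  if-false : ∀ {b} {x y : ℤ} → b ≡ false → (if b then x else y) ≡ y
  if-false refl = refl

  ≤ᵇ-true : ∀ {i j} → i ≤ j → (i ≤ᵇ j) ≡ true
  ≤ᵇ-true i≤j = Equivalence.to T-≡ (ℤP.≤⇒≤ᵇ i≤j)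

  ≤ᵇ-false : ∀ {i j} → j < i → (i ≤ᵇ j) ≡ false
  ≤ᵇ-false {i} {j} j<i with i ≤ᵇ j in eq
  ... | false = refl
  ... | true  = ⊥-elim (ℤP.<⇒≱ j<i (ℤP.≤ᵇ⇒≤ (subst T (sym eq) tt)))

inRange-true : ∀ {lo hi x} → lo ≤ x → x < hi → inRange lo hi x ≡ true
inRange-true lo≤x x<hi rewrite ≤ᵇ-true lo≤x | ≤ᵇ-true (i<j⇒i+1≤j x<hi) = refl

inRange-below : ∀ {lo hi x} → x < lo → inRange lo hi x ≡ false
inRange-below x<lo rewrite ≤ᵇ-false x<lo = refl

inRange-above : ∀ {lo hi x} → hi ≤ x → inRange lo hi x ≡ false
inRange-above {lo} {hi} {x} hi≤x rewrite ≤ᵇ-false (ℤP.≤-<-trans hi≤x (i<i+1 x)) = ∧-zeroʳ (lo ≤ᵇ x)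

InBox : Mat → ℤ → ℤ → Bool
InBox D r c = inRange (r0 D) (r1 D) r ∧ inRange (c0 D) (c1 D) c

inBox : ∀ D {r c} → r0 D ≤ r → r < r1 D → c0 D ≤ c → c < c1 D → InBox D r c ≡ true
inBox D r0≤r r<r1 c0≤c c<c1 rewrite inRange-true r0≤r r<r1 | inRange-true c0≤c c<c1 = refl

outBox-rows-below : ∀ D {r c} → r < r0 D → InBox D r c ≡ false
outBox-rows-below D r<r0 rewrite inRange-below {hi = r1 D} r<r0 = refl

outBox-rows-above : ∀ D {r c} → r1 D ≤ r → InBox D r c ≡ false
outBox-rows-above D r1≤r rewrite inRange-above {lo = r0 D} r1≤r = refl

outBox-cols-below : ∀ D {r c} → c < c0 D → InBox D r c ≡ false
outBox-cols-below D {r} c<c0 rewrite inRange-below {hi = c1 D} c<c0 = ∧-zeroʳ (inRange (r0 D) (r1 D) r)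

outBox-cols-above : ∀ D {r c} → c1 D ≤ c → InBox D r c ≡ false
outBox-cols-above D {r} c1≤c rewrite inRange-above {lo = c0 D} c1≤c = ∧-zeroʳ (inRange (r0 D) (r1 D) r)

module _ (A B : Mat) (r c : ℤ) where

  ⊔ᴹ-ent-inˡ : InBox A r c ≡ true → ent (A ⊔ᴹ B) r c ≡ ent A r c
  ⊔ᴹ-ent-inˡ = if-true

  ⊔ᴹ-ent-inʳ : InBox A r c ≡ false → InBox B r c ≡ true → ent (A ⊔ᴹ B) r c ≡ ent B r c
  ⊔ᴹ-ent-inʳ outA inB = trans (if-false outA) (if-true inB)

  ⊔ᴹ-ent-out : InBox A r c ≡ false → InBox B r c ≡ false → ent (A ⊔ᴹ B) r c ≡ 0ℤ
  ⊔ᴹ-ent-out outA outB = trans (if-false outA) (if-false outB)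

  ⊔ᴹ-ent-shared : ent A ≡ ent B → InBox A r c ≡ true ⊎ InBox B r c ≡ true → ent (A ⊔ᴹ B) r c ≡ ent A r c
  ⊔ᴹ-ent-shared _   (inj₁ inA) = ⊔ᴹ-ent-inˡ inA
  ⊔ᴹ-ent-shared A≡B (inj₂ inB) with InBox A r c
  ... | true  = refl
  ... | false = trans (if-true inB) (cong (λ f → f r c) (sym A≡B))

module _ (i0 i1 j0 j1 : ℤ) {r c : ℤ} where

  private
    c-r≡h⇒c≡r+h : c - r ≡ j0 - i0 → c ≡ r + (j0 - i0)
    c-r≡h⇒c≡r+h eq = trans (sym (c-r+r≡c c r)) (trans (cong (_+ r) eq) (ℤP.+-comm (j0 - i0) r))
      where c-r+r≡c : ∀ c r → c - r + r ≡ c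
            c-r+r≡c = solve-∀

  offId-ent-diag : c ≡ r + (j0 - i0) → ent (offId i0 i1 j0 j1) r c ≡ 1ℤ
  offId-ent-diag refl = if-true (eqᵇ-refl (r+h-r≡h r (j0 - i0)))
    where
    r+h-r≡h : ∀ r h → r + h - r ≡ h
    r+h-r≡h = solve-∀
    eqᵇ-refl : ∀ {x y} → x ≡ y → eqᵇ x y ≡ true
    eqᵇ-refl {x} refl rewrite ≤ᵇ-true (ℤP.≤-refl {x}) = refl

  offId-ent-off : c ≢ r + (j0 - i0) → ent (offId i0 i1 j0 j1) r c ≡ 0ℤ
  offId-ent-off c≢ = if-false eqᵇ-false
    where
    eqᵇ-false : eqᵇ (c - r) (j0 - i0) ≡ false
    eqᵇ-false with (c - r) ≤ᵇ (j0 - i0) in le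
    ... | false = refl
    ... | true  = ≤ᵇ-false (ℤP.≤∧≢⇒< (ℤP.≤ᵇ⇒≤ (subst T (sym le) tt)) (λ eq → c≢ (c-r≡h⇒c≡r+h eq)))

isPerm⇒isSubPerm : ∀ {D} → IsPerm D → IsSubPerm D
isPerm⇒isSubPerm (zero-one , rows , cols) =
  zero-one , (λ r p q → ℤP.≤-reflexive (rows r p q)) , (λ c p q → ℤP.≤-reflexive (cols c p q))

sub-isSubPerm : ∀ D {i0 i1 j0 j1} → IsPerm D → r0 D ≤ i0 → i0 ≤ i1 → i1 ≤ r1 D →
                c0 D ≤ j0 → j0 ≤ j1 → j1 ≤ c1 D → IsSubPerm (sub D i0 i1 j0 j1)
sub-isSubPerm D {i0} {i1} {j0} {j1} (zero-one , rows , cols) r0≤i0 i0≤i1 i1≤r1 c0≤j0 j0≤j1 j1≤c1 =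
  (λ r c p q s t → zero-one r c (rowˡ p) (rowʳ q) (colˡ s) (colʳ t)) ,
  (λ r p q → subst (rowSum (sub D i0 i1 j0 j1) r ≤_) (rows r (rowˡ p) (rowʳ q))
               (sumR-mono-⊆ _ c0≤j0 j0≤j1 j1≤c1 (λ c s t → nonneg (zero-one r c (rowˡ p) (rowʳ q) s t)))) ,
  (λ c p q → subst (colSum (sub D i0 i1 j0 j1) c ≤_) (cols c (colˡ p) (colʳ q))
               (sumR-mono-⊆ _ r0≤i0 i0≤i1 i1≤r1 (λ r s t → nonneg (zero-one r c s t (colˡ p) (colʳ q)))))
  where
  rowˡ : ∀ {r} → i0 ≤ r → r0 D ≤ r
  rowˡ = ℤP.≤-trans r0≤i0
  rowʳ : ∀ {r} → r < i1 → r < r1 D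
  rowʳ r<i1 = ℤP.<-≤-trans r<i1 i1≤r1
  colˡ : ∀ {c} → j0 ≤ c → c0 D ≤ c
  colˡ = ℤP.≤-trans c0≤j0
  colʳ : ∀ {c} → c < j1 → c < c1 D
  colʳ c<j1 = ℤP.<-≤-trans c<j1 j1≤c1
  nonneg : ∀ {x} → x ≡ 0ℤ ⊎ x ≡ 1ℤ → 0ℤ ≤ x
  nonneg (inj₁ refl) = ℤP.≤-refl
  nonneg (inj₂ refl) = 0≤+d 1

distΣ-bounds : ∀ D {R C} i j → r1 D ≡ R → c0 D ≡ C →
               distΣ D i j ≡ sumR (λ r → sumR (λ c → ent D r c) C j) i R
distΣ-bounds D i j refl refl = refl

module _ {A : Set} (x y : List A) (f : ℤ → ℤ → ℤ) where

  private
    p = + length x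
    q = + length y
    0≤q = 0≤+d (length y)

  distΣ-Psp⊔Pss : ∀ {i j} → - p ≤ i → i ≤ q → 0ℤ ≤ j → j ≤ q →
                  distΣ (Psp x y f ⊔ᴹ Pss x y f) i j ≡ distΣ (swMat x y f) i j
  distΣ-Psp⊔Pss {i} {j} -p≤i i≤q 0≤j j≤q =
    trans (distΣ-bounds (Psp x y f ⊔ᴹ Pss x y f) i j (ℤP.i≤j⇒i⊔j≡j 0≤q) refl)
          (sumR-cong _ _ i≤q (λ r i≤r r<q → sumR-cong _ _ 0≤j (λ c 0≤c c<j →
             ⊔ᴹ-ent-shared (Psp x y f) (Pss x y f) r c refl
               (in-either r c (ℤP.≤-trans -p≤i i≤r) r<q 0≤c (ℤP.<-≤-trans c<j j≤q)))))
    where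
    in-either : ∀ r c → - p ≤ r → r < q → 0ℤ ≤ c → c < q →
                InBox (Psp x y f) r c ≡ true ⊎ InBox (Pss x y f) r c ≡ true
    in-either r c -p≤r r<q 0≤c c<q with r ℤP.<? 0ℤ
    ... | yes r<0 = inj₁ (inBox (Psp x y f) -p≤r r<0 0≤c c<q)
    ... | no r≮0  = inj₂ (inBox (Pss x y f) (ℤP.≮⇒≥ r≮0) r<q 0≤c c<q)

  distΣ-Pss⊔Pps : ∀ {j k} → 0ℤ ≤ j → j ≤ q → 0ℤ ≤ k → k ≤ p + q →
                  distΣ (Pss x y f ⊔ᴹ Pps x y f) j k ≡ distΣ (swMat x y f) j k
  distΣ-Pss⊔Pps {j} {k} 0≤j j≤q 0≤k k≤p+q =
    trans (distΣ-bounds (Pss x y f ⊔ᴹ Pps x y f) j k (ℤP.i≤j⇒i⊔j≡j (ℤP.≤-refl {q})) (ℤP.i≤j⇒i⊓j≡i 0≤q))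
          (sumR-cong _ _ j≤q (λ r j≤r r<q → sumR-cong _ _ 0≤k (λ c 0≤c c<k →
             ⊔ᴹ-ent-shared (Pss x y f) (Pps x y f) r c refl
               (in-either r c (ℤP.≤-trans 0≤j j≤r) r<q 0≤c (ℤP.<-≤-trans c<k k≤p+q)))))
    where
    in-either : ∀ r c → 0ℤ ≤ r → r < q → 0ℤ ≤ c → c < p + q →
                InBox (Pss x y f) r c ≡ true ⊎ InBox (Pps x y f) r c ≡ true
    in-either r c 0≤r r<q 0≤c c<p+q with c ℤP.<? q
    ... | yes c<q = inj₁ (inBox (Pss x y f) 0≤r r<q 0≤c c<q)
    ... | no c≮q  = inj₂ (inBox (Pps x y f) 0≤r r<q (ℤP.≮⇒≥ c≮q) c<p+q)

-- Extending a seaweed matrix by an offset identity block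

private
  j-i-[[j-a]⊔i-i]≡[j-i]⊓a : ∀ i j a → j - i - (((j - a) ⊔ i) - i) ≡ (j - i) ⊓ a
  j-i-[[j-a]⊔i-i]≡[j-i]⊓a i j a = begin
    j - i - (((j - a) ⊔ i) - i)      ≡⟨ j-i-[t-i]≡j-t i j ((j - a) ⊔ i) ⟩
    j - ((j - a) ⊔ i)                ≡⟨ ℤP.antimono-≤-distrib-⊔ (λ x≤y → ℤP.+-monoʳ-≤ j (ℤP.neg-mono-≤ x≤y))
                                                                (j - a) i ⟩
    (j - (j - a)) ⊓ (j - i)          ≡⟨ cong (_⊓ (j - i)) (j-[j-a]≡a j a) ⟩
    a ⊓ (j - i)                      ≡⟨ ℤP.⊓-comm a (j - i) ⟩
    (j - i) ⊓ a                      ∎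
    where
    open ≡-Reasoning
    j-i-[t-i]≡j-t : ∀ i j t → j - i - (t - i) ≡ j - t
    j-i-[t-i]≡j-t = solve-∀
    j-[j-a]≡a : ∀ j a → j - (j - a) ≡ a
    j-[j-a]≡a = solve-∀

-- The identity block has l rows: l = |a″| when x = a′ here, and l = |a′| when x = a″ in the next module.
module _ {A : Set} (x y : List A) (f : ℤ → ℤ → ℤ) (l : ℕ) where

  private
    p = + length x
    e = + l
    q = + length y
    I = offId (- (p + e)) (- p) (- e) 0ℤ
    M = I ⊔ᴹ swMat x y f

    row : ℤ → ℤ → ℤ
    row j r = sumR (λ c → ent M r c) (- e) j

    -p≤0 = -d≤0 (length x)
    -e≤0 = -d≤0 l
    0≤q = 0≤+d (length y)

    offset≡ : - e - - (p + e) ≡ p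
    offset≡ = -e--[p+e]≡p e p
      where -e--[p+e]≡p : ∀ e p → - e - - (p + e) ≡ p
            -e--[p+e]≡p = solve-∀

    ent-P : ∀ {r c} → - p ≤ r → r < q → 0ℤ ≤ c → c < p + q → ent M r c ≡ f r c
    ent-P {r} {c} -p≤r r<q 0≤c c<p+q = ⊔ᴹ-ent-inʳ I (swMat x y f) r c
      (outBox-rows-above I -p≤r) (inBox (swMat x y f) -p≤r r<q 0≤c c<p+q)

    ent-P-left : ∀ {r c} → - p ≤ r → c < 0ℤ → ent M r c ≡ 0ℤ
    ent-P-left {r} {c} -p≤r c<0 = ⊔ᴹ-ent-out I (swMat x y f) r c
      (outBox-rows-above I -p≤r) (outBox-cols-below (swMat x y f) c<0)

    ent-I-right : ∀ {r c} → r < - p → 0ℤ ≤ c → ent M r c ≡ 0ℤ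
    ent-I-right {r} {c} r<-p 0≤c = ⊔ᴹ-ent-out I (swMat x y f) r c
      (outBox-cols-above I 0≤c) (outBox-rows-below (swMat x y f) {c = c} r<-p)

    ent-I : ∀ {r c} → - (p + e) ≤ r → r < - p → - e ≤ c → c < 0ℤ → ent M r c ≡ ent I r c
    ent-I {r} {c} r≥ r<-p c≥ c<0 = ⊔ᴹ-ent-inˡ I (swMat x y f) r c (inBox I r≥ r<-p c≥ c<0)

    ent-I-diag : ∀ {r c} → c ≡ r + p → ent I r c ≡ 1ℤ
    ent-I-diag {r} c≡ = offId-ent-diag (- (p + e)) (- p) (- e) 0ℤ (trans c≡ (cong (_+_ r) (sym offset≡)))

    ent-I-off : ∀ {r c} → c ≢ r + p → ent I r c ≡ 0ℤ
    ent-I-off {r} c≢ = offId-ent-off (- (p + e)) (- p) (- e) 0ℤ (λ c≡ → c≢ (trans c≡ (cong (_+_ r) offset≡)))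

    row-P : ∀ {j r} → - p ≤ r → r < q → 0ℤ ≤ j → j ≤ p + q → row j r ≡ sumR (λ c → f r c) 0ℤ j
    row-P {j} {r} -p≤r r<q 0≤j j≤p+q = begin
      row j r                                    ≡⟨ sumR-split _ -e≤0 0≤j ⟩
      sumR (λ c → ent M r c) (- e) 0ℤ + sumR (λ c → ent M r c) 0ℤ j
        ≡⟨ cong₂ _+_ (sumR-zero _ -e≤0 (λ c _ c<0 → ent-P-left -p≤r c<0))
                     (sumR-cong _ _ 0≤j (λ c 0≤c c<j → ent-P -p≤r r<q 0≤c (ℤP.<-≤-trans c<j j≤p+q))) ⟩
      0ℤ + sumR (λ c → f r c) 0ℤ j              ≡⟨ ℤP.+-identityˡ _ ⟩
      sumR (λ c → f r c) 0ℤ j                   ∎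
      where open ≡-Reasoning

    row-P-left : ∀ {j r} → - p ≤ r → - e ≤ j → j ≤ 0ℤ → row j r ≡ 0ℤ
    row-P-left -p≤r -e≤j j≤0 = sumR-zero _ -e≤j (λ c _ c<j → ent-P-left -p≤r (ℤP.<-≤-trans c<j j≤0))

    row-I-on : ∀ {j r} → - (p + e) ≤ r → r < - p → r + p < j → row j r ≡ 1ℤ
    row-I-on {j} {r} r≥ r<-p r+p<j = sumR-single _ -e≤r+p r+p<j on off
      where
      -e≤r+p : - e ≤ r + p
      -e≤r+p = subst (_≤ r + p) (-[p+e]+p≡-e p e) (ℤP.+-monoˡ-≤ p r≥)
        where -[p+e]+p≡-e : ∀ p e → - (p + e) + p ≡ - e
              -[p+e]+p≡-e = solve-∀
      r+p<0 : r + p < 0ℤ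
      r+p<0 = subst (r + p <_) (ℤP.+-inverseˡ p) (ℤP.+-monoˡ-< p r<-p)
      on : ent M r (r + p) ≡ 1ℤ
      on = trans (ent-I r≥ r<-p -e≤r+p r+p<0) (ent-I-diag {r} refl)
      off : ∀ c → - e ≤ c → c < j → c ≢ r + p → ent M r c ≡ 0ℤ
      off c -e≤c _ c≢ with c ℤP.<? 0ℤ
      ... | yes c<0 = trans (ent-I r≥ r<-p -e≤c c<0) (ent-I-off c≢)
      ... | no c≮0  = ent-I-right r<-p (ℤP.≮⇒≥ c≮0)

    row-I-off : ∀ {j r} → - (p + e) ≤ r → r < - p → - e ≤ j → j ≤ r + p → row j r ≡ 0ℤ
    row-I-off {j} {r} r≥ r<-p -e≤j j≤r+p = sumR-zero _ -e≤j off
      where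
      off : ∀ c → - e ≤ c → c < j → ent M r c ≡ 0ℤ
      off c -e≤c c<j with c ℤP.<? 0ℤ
      ... | yes c<0 = trans (ent-I r≥ r<-p -e≤c c<0) (ent-I-off (ℤP.<⇒≢ (ℤP.<-≤-trans c<j j≤r+p)))
      ... | no c≮0  = ent-I-right r<-p (ℤP.≮⇒≥ c≮0)

    distΣ-rows : ∀ i j → distΣ M i j ≡ sumR (row j) i q
    distΣ-rows i j = distΣ-bounds M i j (ℤP.i≤j⇒i⊔j≡j (ℤP.≤-trans -p≤0 0≤q)) (ℤP.i≤j⇒i⊓j≡i -e≤0)

    rows-P : ∀ {i j} → - p ≤ i → i ≤ q → 0ℤ ≤ j → j ≤ p + q → sumR (row j) i q ≡ distΣ (swMat x y f) i j
    rows-P -p≤i i≤q 0≤j j≤p+q = sumR-cong _ _ i≤q (λ r i≤r r<q → row-P (ℤP.≤-trans -p≤i i≤r) r<q 0≤j j≤p+q)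

    distΣ-inner : ∀ {i j} → - p ≤ i → i ≤ q → 0ℤ ≤ j → j ≤ p + q → distΣ M i j ≡ distΣ (swMat x y f) i j
    distΣ-inner {i} {j} -p≤i i≤q 0≤j j≤p+q = trans (distΣ-rows i j) (rows-P -p≤i i≤q 0≤j j≤p+q)

    distΣ-outer : ∀ {i j} → - (p + e) ≤ i → i < - p → 0ℤ ≤ j → j ≤ p + q →
                  distΣ M i j ≡ (- p - i) + distΣ (swMat x y f) (- p) j
    distΣ-outer {i} {j} i≥ i<-p 0≤j j≤p+q = begin
      distΣ M i j                              ≡⟨ distΣ-rows i j ⟩
      sumR (row j) i q                         ≡⟨ sumR-split _ (ℤP.<⇒≤ i<-p) -p≤q ⟩
      sumR (row j) i (- p) + sumR (row j) (- p) q
        ≡⟨ cong₂ _+_ (sumR-one _ (ℤP.<⇒≤ i<-p) (λ r i≤r r<-p → row-I-on (ℤP.≤-trans i≥ i≤r) r<-p (r+p<j r<-p)))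
                     (rows-P ℤP.≤-refl -p≤q 0≤j j≤p+q) ⟩
      (- p - i) + distΣ (swMat x y f) (- p) j ∎
      where
      open ≡-Reasoning
      -p≤q = ℤP.≤-trans -p≤0 0≤q
      r+p<j : ∀ {r} → r < - p → r + p < j
      r+p<j {r} r<-p = ℤP.<-≤-trans (subst (r + p <_) (ℤP.+-inverseˡ p) (ℤP.+-monoˡ-< p r<-p)) 0≤j

    distΣ-left : ∀ {i j} → - (p + e) ≤ i → i ≤ q → - e ≤ j → j ≤ 0ℤ → distΣ M i j ≡ ((j - p) ⊔ i) - i
    distΣ-left {i} {j} i≥ i≤q -e≤j j≤0 =
      trans (distΣ-rows i j) (sumR-step _ (ℤP.i≤j⊔i (j - p) i) t≤q on off)
      where
      t = (j - p) ⊔ i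
      j-p≤-p : j - p ≤ - p
      j-p≤-p = subst (j - p ≤_) (ℤP.+-identityˡ (- p)) (ℤP.+-monoˡ-≤ (- p) j≤0)
      t≤q = ℤP.⊔-lub (ℤP.≤-trans j-p≤-p (ℤP.≤-trans -p≤0 0≤q)) i≤q
      on : ∀ r → i ≤ r → r < t → row j r ≡ 1ℤ
      on r i≤r r<t = row-I-on {j} (ℤP.≤-trans i≥ i≤r) (ℤP.<-≤-trans r<j-p j-p≤-p) (r<j-a⇒r+a<j r<j-p)
        where r<j-p = ℤP.≰⇒> (λ j-p≤r → ℤP.<⇒≱ r<t (ℤP.⊔-lub j-p≤r i≤r))
      off : ∀ r → t ≤ r → r < q → row j r ≡ 0ℤ
      off r t≤r r<q with r ℤP.<? - p
      ... | yes r<-p = row-I-off (ℤP.≤-trans i≥ (ℤP.≤-trans (ℤP.i≤j⊔i (j - p) i) t≤r)) r<-p -e≤j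
                                  (j-a≤r⇒j≤r+a (ℤP.≤-trans (ℤP.i≤i⊔j (j - p) i) t≤r))
      ... | no r≮-p  = row-P-left (ℤP.≮⇒≥ r≮-p) -e≤j j≤0

  -- Left of column 0 the window consists of wildcards; left of row −p the score saturates at
  -- |x| = p, just as it does at row −p, and each identity row adds the one crossing this loses.
  score-offId⊔ᴹswMat : IsSeaweed x y f → ∀ i j → - (p + e) ≤ i → i ≤ q → - e ≤ j → j ≤ p + q →
               HScore x y i j (j - i - distΣ M i j)
  score-offId⊔ᴹswMat S i j i≥ i≤q -e≤j j≤p+q with j ℤP.≤? 0ℤ | - p ℤP.≤? i
  ... | yes j≤0 | _ = subst (HScore x y i j) value≡ (score-wildcards (wildcards-left y j≤0))
    where value≡ : (j - i) ⊓ p ≡ j - i - distΣ M i j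
          value≡ = sym (trans (cong (λ D → j - i - D) (distΣ-left i≥ i≤q -e≤j j≤0)) (j-i-[[j-a]⊔i-i]≡[j-i]⊓a i j p))
  ... | no j≰0 | yes -p≤i = subst (λ D → HScore x y i j (j - i - D)) (sym (distΣ-inner -p≤i i≤q 0≤j j≤p+q))
                                  (proj₂ S i j -p≤i i≤q 0≤j j≤p+q)
    where 0≤j = ℤP.<⇒≤ (ℤP.≰⇒> j≰0)
  ... | no j≰0 | no -p≰i = subst (HScore x y i j) (sym value≡) (score-full i≤-p -p≤0 0≤j (wildcards-left y ℤP.≤-refl) p≤0--p)
    where
    0≤j = ℤP.<⇒≤ (ℤP.≰⇒> j≰0)
    i≤-p = ℤP.<⇒≤ (ℤP.≰⇒> -p≰i)
    D = distΣ (swMat x y f) (- p) j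
    p≤0--p : p ≤ 0ℤ - - p
    p≤0--p = ℤP.≤-reflexive (sym (0--p≡p p))
      where 0--p≡p : ∀ p → 0ℤ - - p ≡ p
            0--p≡p = solve-∀
    full-at-−p : j - - p - D ≡ p
    full-at-−p = score-unique (proj₂ S (- p) j ℤP.≤-refl (ℤP.≤-trans -p≤0 0≤q) 0≤j j≤p+q)
                              (score-full ℤP.≤-refl -p≤0 0≤j (wildcards-left y ℤP.≤-refl) p≤0--p)
    value≡ : j - i - distΣ M i j ≡ p
    value≡ = begin
      j - i - distΣ M i j        ≡⟨ cong (λ D′ → j - i - D′) (distΣ-outer i≥ (ℤP.≰⇒> -p≰i) 0≤j j≤p+q) ⟩
      j - i - ((- p - i) + D)    ≡⟨ j-i-[[-p-i]+D]≡j--p-D i j p D ⟩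
      j - - p - D                ≡⟨ full-at-−p ⟩
      p                          ∎
      where
      open ≡-Reasoning
      j-i-[[-p-i]+D]≡j--p-D : ∀ i j p D → j - i - ((- p - i) + D) ≡ j - - p - D
      j-i-[[-p-i]+D]≡j--p-D = solve-∀

module _ {A : Set} (x y : List A) (f : ℤ → ℤ → ℤ) (l : ℕ) where

  private
    p = + length x
    e = + l
    q = + length y
    I = offId q (e + q) (p + q) ((e + p) + q)
    M = swMat x y f ⊔ᴹ I

    row : ℤ → ℤ → ℤ
    row k r = sumR (λ c → ent M r c) 0ℤ k

    -p≤0 = -d≤0 (length x)
    0≤q = 0≤+d (length y)
    q≤e+q = ℤP.i≤j+i q e
    p+q≤e+p+q = ℤP.+-monoˡ-≤ q (ℤP.i≤j+i p e)

    offset≡ : (p + q) - q ≡ p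
    offset≡ = p+q-q≡p p q
      where p+q-q≡p : ∀ p q → (p + q) - q ≡ p
            p+q-q≡p = solve-∀

    ent-P : ∀ {r c} → - p ≤ r → r < q → 0ℤ ≤ c → c < p + q → ent M r c ≡ f r c
    ent-P {r} {c} -p≤r r<q 0≤c c<p+q = ⊔ᴹ-ent-inˡ (swMat x y f) I r c (inBox (swMat x y f) -p≤r r<q 0≤c c<p+q)

    ent-P-right : ∀ {r c} → r < q → p + q ≤ c → ent M r c ≡ 0ℤ
    ent-P-right {r} {c} r<q p+q≤c = ⊔ᴹ-ent-out (swMat x y f) I r c
      (outBox-cols-above (swMat x y f) p+q≤c) (outBox-rows-below I {c = c} r<q)

    ent-I-left : ∀ {r c} → q ≤ r → c < p + q → ent M r c ≡ 0ℤ
    ent-I-left {r} {c} q≤r c<p+q = ⊔ᴹ-ent-out (swMat x y f) I r c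
      (outBox-rows-above (swMat x y f) {c = c} q≤r) (outBox-cols-below I {r = r} c<p+q)

    ent-I : ∀ {r c} → q ≤ r → r < e + q → p + q ≤ c → c < (e + p) + q → ent M r c ≡ ent I r c
    ent-I {r} {c} q≤r r<e+q c≥ c< = ⊔ᴹ-ent-inʳ (swMat x y f) I r c
      (outBox-rows-above (swMat x y f) {c = c} q≤r) (inBox I q≤r r<e+q c≥ c<)

    ent-I-diag : ∀ {r c} → c ≡ r + p → ent I r c ≡ 1ℤ
    ent-I-diag {r} c≡ = offId-ent-diag q (e + q) (p + q) ((e + p) + q) (trans c≡ (cong (_+_ r) (sym offset≡)))

    ent-I-off : ∀ {r c} → c ≢ r + p → ent I r c ≡ 0ℤ
    ent-I-off {r} c≢ = offId-ent-off q (e + q) (p + q) ((e + p) + q) (λ c≡ → c≢ (trans c≡ (cong (_+_ r) offset≡)))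

    row-P : ∀ {k r} → - p ≤ r → r < q → 0ℤ ≤ k → k ≤ p + q → row k r ≡ sumR (λ c → f r c) 0ℤ k
    row-P -p≤r r<q 0≤k k≤p+q = sumR-cong _ _ 0≤k (λ c 0≤c c<k → ent-P -p≤r r<q 0≤c (ℤP.<-≤-trans c<k k≤p+q))

    row-P-full : ∀ {k r} → - p ≤ r → r < q → p + q ≤ k → row k r ≡ sumR (λ c → f r c) 0ℤ (p + q)
    row-P-full {k} {r} -p≤r r<q p+q≤k = begin
      row k r                                                    ≡⟨ sumR-split _ 0≤p+q p+q≤k ⟩
      row (p + q) r + sumR (λ c → ent M r c) (p + q) k           ≡⟨ cong₂ _+_ (row-P -p≤r r<q 0≤p+q ℤP.≤-refl)
                                                                      (sumR-zero _ p+q≤k (λ c p+q≤c _ → ent-P-right r<q p+q≤c)) ⟩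
      sumR (λ c → f r c) 0ℤ (p + q) + 0ℤ                         ≡⟨ ℤP.+-identityʳ _ ⟩
      sumR (λ c → f r c) 0ℤ (p + q)                              ∎
      where open ≡-Reasoning
            0≤p+q = ℤP.≤-trans 0≤q (ℤP.i≤j+i q p)

    row-I-on : ∀ {k r} → q ≤ r → r < e + q → r + p < k → k ≤ (e + p) + q → row k r ≡ 1ℤ
    row-I-on {k} {r} q≤r r<e+q r+p<k k≤ = sumR-single _ 0≤r+p r+p<k on off
      where
      p+q≤r+p : p + q ≤ r + p
      p+q≤r+p = subst (_≤ r + p) (ℤP.+-comm q p) (ℤP.+-monoˡ-≤ p q≤r)
      0≤r+p = ℤP.≤-trans (ℤP.≤-trans 0≤q (ℤP.i≤j+i q p)) p+q≤r+p
      on : ent M r (r + p) ≡ 1ℤ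
      on = trans (ent-I q≤r r<e+q p+q≤r+p (ℤP.<-≤-trans r+p<k k≤)) (ent-I-diag {r} refl)
      off : ∀ c → 0ℤ ≤ c → c < k → c ≢ r + p → ent M r c ≡ 0ℤ
      off c _ c<k c≢ with p + q ℤP.≤? c
      ... | yes p+q≤c = trans (ent-I q≤r r<e+q p+q≤c (ℤP.<-≤-trans c<k k≤)) (ent-I-off c≢)
      ... | no p+q≰c  = ent-I-left q≤r (ℤP.≰⇒> p+q≰c)

    row-I-off : ∀ {k r} → q ≤ r → r < e + q → 0ℤ ≤ k → k ≤ r + p → k ≤ (e + p) + q → row k r ≡ 0ℤ
    row-I-off {k} {r} q≤r r<e+q 0≤k k≤r+p k≤ = sumR-zero _ 0≤k off
      where
      off : ∀ c → 0ℤ ≤ c → c < k → ent M r c ≡ 0ℤ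
      off c _ c<k with p + q ℤP.≤? c
      ... | yes p+q≤c = trans (ent-I q≤r r<e+q p+q≤c (ℤP.<-≤-trans c<k k≤))
                              (ent-I-off (ℤP.<⇒≢ (ℤP.<-≤-trans c<k k≤r+p)))
      ... | no p+q≰c  = ent-I-left q≤r (ℤP.≰⇒> p+q≰c)

    distΣ-rows : ∀ j k → distΣ M j k ≡ sumR (row k) j (e + q)
    distΣ-rows j k = distΣ-bounds M j k (ℤP.i≤j⇒i⊔j≡j q≤e+q) (ℤP.i≤j⇒i⊓j≡i (ℤP.≤-trans 0≤q (ℤP.i≤j+i q p)))

    rows-P : ∀ {j k} → - p ≤ j → j ≤ q → 0ℤ ≤ k → k ≤ p + q → sumR (row k) j q ≡ distΣ (swMat x y f) j k
    rows-P -p≤j j≤q 0≤k k≤p+q = sumR-cong _ _ j≤q (λ r j≤r r<q → row-P (ℤP.≤-trans -p≤j j≤r) r<q 0≤k k≤p+q)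

    distΣ-inner : ∀ {j k} → - p ≤ j → j ≤ q → 0ℤ ≤ k → k ≤ p + q → distΣ M j k ≡ distΣ (swMat x y f) j k
    distΣ-inner {j} {k} -p≤j j≤q 0≤k k≤p+q = begin
      distΣ M j k                                       ≡⟨ distΣ-rows j k ⟩
      sumR (row k) j (e + q)                            ≡⟨ sumR-split _ j≤q q≤e+q ⟩
      sumR (row k) j q + sumR (row k) q (e + q)         ≡⟨ cong₂ _+_ (rows-P -p≤j j≤q 0≤k k≤p+q)
                                                             (sumR-zero _ q≤e+q (λ r q≤r r<e+q → row-I-off q≤r r<e+q 0≤k
                                                                (k≤r+p q≤r) (ℤP.≤-trans k≤p+q p+q≤e+p+q))) ⟩
      distΣ (swMat x y f) j k + 0ℤ                      ≡⟨ ℤP.+-identityʳ _ ⟩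
      distΣ (swMat x y f) j k                           ∎
      where
      open ≡-Reasoning
      k≤r+p : ∀ {r} → q ≤ r → k ≤ r + p
      k≤r+p {r} q≤r = ℤP.≤-trans k≤p+q (subst (_≤ r + p) (ℤP.+-comm q p) (ℤP.+-monoˡ-≤ p q≤r))

    distΣ-outer : ∀ {j k} → - p ≤ j → j ≤ q → p + q < k → k ≤ (e + p) + q →
                  distΣ M j k ≡ distΣ (swMat x y f) j (p + q) + ((k - p) - q)
    distΣ-outer {j} {k} -p≤j j≤q p+q<k k≤ = begin
      distΣ M j k                                       ≡⟨ distΣ-rows j k ⟩
      sumR (row k) j (e + q)                            ≡⟨ sumR-split _ j≤q q≤e+q ⟩
      sumR (row k) j q + sumR (row k) q (e + q)
        ≡⟨ cong₂ _+_ (sumR-cong _ _ j≤q (λ r j≤r r<q → row-P-full (ℤP.≤-trans -p≤j j≤r) r<q (ℤP.<⇒≤ p+q<k)))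
                     (sumR-step _ q≤k-p k-p≤e+q
                        (λ r q≤r r<k-p → row-I-on q≤r (ℤP.<-≤-trans r<k-p k-p≤e+q) (r<j-a⇒r+a<j r<k-p) k≤)
                        (λ r k-p≤r r<e+q → row-I-off (ℤP.≤-trans q≤k-p k-p≤r) r<e+q 0≤k (j-a≤r⇒j≤r+a k-p≤r) k≤)) ⟩
      distΣ (swMat x y f) j (p + q) + ((k - p) - q)     ∎
      where
      open ≡-Reasoning
      0≤k = ℤP.≤-trans (ℤP.≤-trans 0≤q (ℤP.i≤j+i q p)) (ℤP.<⇒≤ p+q<k)
      q≤k-p : q ≤ k - p
      q≤k-p = subst (_≤ k - p) (p+q-p≡q p q) (ℤP.+-monoˡ-≤ (- p) (ℤP.<⇒≤ p+q<k))
        where p+q-p≡q : ∀ p q → p + q - p ≡ q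
              p+q-p≡q = solve-∀
      k-p≤e+q : k - p ≤ e + q
      k-p≤e+q = subst (k - p ≤_) (e+p+q-p≡e+q e p q) (ℤP.+-monoˡ-≤ (- p) k≤)
        where e+p+q-p≡e+q : ∀ e p q → (e + p) + q - p ≡ e + q
              e+p+q-p≡e+q = solve-∀

    distΣ-right : ∀ {j k} → q ≤ j → j ≤ e + q → 0ℤ ≤ k → k ≤ (e + p) + q → distΣ M j k ≡ ((k - p) ⊔ j) - j
    distΣ-right {j} {k} q≤j j≤e+q 0≤k k≤ =
      trans (distΣ-rows j k) (sumR-step _ (ℤP.i≤j⊔i (k - p) j) t≤e+q on off)
      where
      t = (k - p) ⊔ j
      t≤e+q = ℤP.⊔-lub (subst (k - p ≤_) (e+p+q-p≡e+q e p q) (ℤP.+-monoˡ-≤ (- p) k≤)) j≤e+q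
        where e+p+q-p≡e+q : ∀ e p q → (e + p) + q - p ≡ e + q
              e+p+q-p≡e+q = solve-∀
      on : ∀ r → j ≤ r → r < t → row k r ≡ 1ℤ
      on r j≤r r<t = row-I-on (ℤP.≤-trans q≤j j≤r) (ℤP.<-≤-trans r<t t≤e+q) (r<j-a⇒r+a<j r<k-p) k≤
        where r<k-p = ℤP.≰⇒> (λ k-p≤r → ℤP.<⇒≱ r<t (ℤP.⊔-lub k-p≤r j≤r))
      off : ∀ r → t ≤ r → r < e + q → row k r ≡ 0ℤ
      off r t≤r r<e+q = row-I-off (ℤP.≤-trans q≤j (ℤP.≤-trans (ℤP.i≤j⊔i (k - p) j) t≤r)) r<e+q 0≤k
                                  (j-a≤r⇒j≤r+a (ℤP.≤-trans (ℤP.i≤i⊔j (k - p) j) t≤r)) k≤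

  score-swMat⊔ᴹoffId : IsSeaweed x y f → ∀ j k → - p ≤ j → j ≤ e + q → 0ℤ ≤ k → k ≤ (e + p) + q →
               HScore x y j k (k - j - distΣ M j k)
  score-swMat⊔ᴹoffId S j k -p≤j j≤e+q 0≤k k≤ with q ℤP.≤? j | k ℤP.≤? p + q
  ... | yes q≤j | _ = subst (HScore x y j k) value≡ (score-wildcards (wildcards-right y q≤j))
    where value≡ : (k - j) ⊓ p ≡ k - j - distΣ M j k
          value≡ = sym (trans (cong (λ D → k - j - D) (distΣ-right q≤j j≤e+q 0≤k k≤)) (j-i-[[j-a]⊔i-i]≡[j-i]⊓a j k p))
  ... | no q≰j | yes k≤p+q = subst (λ D → HScore x y j k (k - j - D)) (sym (distΣ-inner -p≤j j≤q 0≤k k≤p+q))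
                                   (proj₂ S j k -p≤j j≤q 0≤k k≤p+q)
    where j≤q = ℤP.<⇒≤ (ℤP.≰⇒> q≰j)
  ... | no q≰j | no k≰p+q = subst (HScore x y j k) (sym value≡) (score-full j≤q q≤p+q p+q≤k wild-right p≤p+q-q)
    where
    j≤q = ℤP.<⇒≤ (ℤP.≰⇒> q≰j)
    p+q<k = ℤP.≰⇒> k≰p+q
    p+q≤k = ℤP.<⇒≤ p+q<k
    q≤p+q = ℤP.i≤j+i q p
    wild-right = wildcards-right y ℤP.≤-refl
    p≤p+q-q : p ≤ (p + q) - q
    p≤p+q-q = ℤP.≤-reflexive (sym offset≡)
    D = distΣ (swMat x y f) j (p + q)
    full-at-p+q : (p + q) - j - D ≡ p
    full-at-p+q = score-unique (proj₂ S j (p + q) -p≤j j≤q (ℤP.≤-trans 0≤q q≤p+q) ℤP.≤-refl)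
                               (score-full j≤q q≤p+q ℤP.≤-refl wild-right p≤p+q-q)
    value≡ : k - j - distΣ M j k ≡ p
    value≡ = begin
      k - j - distΣ M j k              ≡⟨ cong (λ D′ → k - j - D′) (distΣ-outer -p≤j j≤q p+q<k k≤) ⟩
      k - j - (D + ((k - p) - q))      ≡⟨ k-j-[D+[k-p-q]]≡[p+q]-j-D j k p q D ⟩
      (p + q) - j - D                  ≡⟨ full-at-p+q ⟩
      p                                ∎
      where
      open ≡-Reasoning
      k-j-[D+[k-p-q]]≡[p+q]-j-D : ∀ j k p q D → k - j - (D + ((k - p) - q)) ≡ (p + q) - j - D
      k-j-[D+[k-p-q]]≡[p+q]-j-D = solve-∀

-- The three distance-product decompositions

module _ {A : Set} (a′ a″ b : List A) (P P′ P″ : ℤ → ℤ → ℤ)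
         (S : IsSeaweed (a′ ++ a″) b P) (S′ : IsSeaweed a′ b P′) (S″ : IsSeaweed a″ b P″) where

  private
    m′ = + length a′
    m″ = + length a″
    n  = + length b
    0≤n = 0≤+d (length b)

    length-a≡ : + length (a′ ++ a″) ≡ m′ + m″
    length-a≡ = trans (cong +_ (ListP.length-++ a′)) (ℤP.pos-+ (length a′) (length a″))

    -a≤-m′ : - + length (a′ ++ a″) ≤ - m′
    -a≤-m′ = ℤP.neg-mono-≤ (subst (m′ ≤_) (sym length-a≡) (ℤP.i≤i+j m′ m″))

    m″+n≤a+n : m″ + n ≤ + length (a′ ++ a″) + n
    m″+n≤a+n = ℤP.+-monoˡ-≤ n (subst (m″ ≤_) (sym length-a≡) (ℤP.i≤j+i m″ m′))

  isDistProd-Pss : IsDistProd (Pss a′ b P′) (Pss a″ b P″) (Pss (a′ ++ a″) b P)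
  isDistProd-Pss = refl , refl , refl , refl , refl , refl ,
    sub-isSubPerm (swMat (a′ ++ a″) b P) (proj₁ S) (-d≤0 _) 0≤n ℤP.≤-refl ℤP.≤-refl 0≤n (ℤP.i≤j+i n _) ,
    λ i k 0≤i i≤n 0≤k k≤n → sym (minR-deficit-++ a′ a″ b _ _ _
      (λ j 0≤j j≤n → proj₂ S′ i j (ℤP.≤-trans (-d≤0 _) 0≤i) i≤n 0≤j (ℤP.≤-trans j≤n (ℤP.i≤j+i n m′)))
      (λ j 0≤j j≤n → proj₂ S″ j k (ℤP.≤-trans (-d≤0 _) 0≤j) j≤n 0≤k (ℤP.≤-trans k≤n (ℤP.i≤j+i n m″)))
      (proj₂ S i k (ℤP.≤-trans (-d≤0 _) 0≤i) i≤n 0≤k (ℤP.≤-trans k≤n (ℤP.i≤j+i n _)))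
      0≤n 0≤k i≤n (λ i<0 → ⊥-elim (ℤP.<⇒≱ i<0 0≤i)) (λ n<k → ⊥-elim (ℤP.<⇒≱ n<k k≤n)))

  private
    distΣ-Pcross≡minR : ∀ {i k} → - m′ ≤ i → i ≤ n → 0ℤ ≤ k → k ≤ m″ + n →
      distΣ (Pcross a′ a″ b P) i k ≡
      minR (λ j → distΣ (Psp a′ b P′ ⊔ᴹ Pss a′ b P′) i j + distΣ (Pss a″ b P″ ⊔ᴹ Pps a″ b P″) j k) 0ℤ n
    distΣ-Pcross≡minR {i} {k} -m′≤i i≤n 0≤k k≤m″+n = sym (minR-deficit-++ a′ a″ b _ _ _
      (λ j 0≤j j≤n → subst (λ D → HScore a′ b i j (j - i - D)) (sym (distΣ-Psp⊔Pss a′ b P′ -m′≤i i≤n 0≤j j≤n))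
                       (proj₂ S′ i j -m′≤i i≤n 0≤j (ℤP.≤-trans j≤n (ℤP.i≤j+i n m′))))
      (λ j 0≤j j≤n → subst (λ D → HScore a″ b j k (k - j - D)) (sym (distΣ-Pss⊔Pps a″ b P″ 0≤j j≤n 0≤k k≤m″+n))
                       (proj₂ S″ j k (ℤP.≤-trans (-d≤0 _) 0≤j) j≤n 0≤k k≤m″+n))
      (proj₂ S i k (ℤP.≤-trans -a≤-m′ -m′≤i) i≤n 0≤k (ℤP.≤-trans k≤m″+n m″+n≤a+n))
      0≤n 0≤k i≤n
      (λ _ → wildcards-left b ℤP.≤-refl , 0-i≤m′)
      (λ _ → wildcards-right b ℤP.≤-refl , k-n≤m″))
      where
      0-i≤m′ : 0ℤ - i ≤ m′
      0-i≤m′ = subst (0ℤ - i ≤_) (trans (ℤP.+-identityˡ _) (ℤP.neg-involutive m′))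
                     (ℤP.+-monoʳ-≤ 0ℤ (ℤP.neg-mono-≤ -m′≤i))
      k-n≤m″ : k - n ≤ m″
      k-n≤m″ = subst (k - n ≤_) (m+n-n≡m m″ n) (ℤP.+-monoˡ-≤ (- n) k≤m″+n)
        where m+n-n≡m : ∀ m n → m + n - n ≡ m
              m+n-n≡m = solve-∀

    distΣ-swMat≡minR : ∀ {i k} → - (m′ + m″) ≤ i → i ≤ n → 0ℤ ≤ k → k ≤ (m′ + m″) + n →
      distΣ (swMat (a′ ++ a″) b P) i k ≡
      minR (λ j → distΣ (offId (- (m′ + m″)) (- m′) (- m″) 0ℤ ⊔ᴹ swMat a′ b P′) i j
                + distΣ (swMat a″ b P″ ⊔ᴹ offId n (m′ + n) (m″ + n) ((m′ + m″) + n)) j k)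
           (- m″) (m′ + n)
    distΣ-swMat≡minR {i} {k} -m≤i i≤n 0≤k k≤m+n = sym (minR-deficit-++ a′ a″ b _ _ _
      (λ j -m″≤j j≤m′+n → score-offId⊔ᴹswMat a′ b P′ (length a″) S′ i j -m≤i i≤n -m″≤j j≤m′+n)
      (λ j -m″≤j j≤m′+n → score-swMat⊔ᴹoffId a″ b P″ (length a′) S″ j k -m″≤j j≤m′+n 0≤k k≤m+n)
      (proj₂ S i k -a≤i i≤n 0≤k k≤a+n)
      (ℤP.≤-trans -m″≤0 (ℤP.≤-trans 0≤n n≤m′+n)) (ℤP.≤-trans -m″≤0 0≤k) (ℤP.≤-trans i≤n n≤m′+n)
      (λ _ → wildcards-left b -m″≤0 , -m″-i≤m′)
      (λ _ → wildcards-right b n≤m′+n , k-[m′+n]≤m″))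
      where
      -m″≤0 = -d≤0 (length a″)
      n≤m′+n = ℤP.i≤j+i n m′
      -a≤i = subst (λ v → - v ≤ i) (sym length-a≡) -m≤i
      k≤a+n = subst (λ v → k ≤ v + n) (sym length-a≡) k≤m+n
      -m″-i≤m′ : - m″ - i ≤ m′
      -m″-i≤m′ = subst (- m″ - i ≤_) (-b--[a+b]≡a m′ m″) (ℤP.+-monoʳ-≤ (- m″) (ℤP.neg-mono-≤ -m≤i))
        where -b--[a+b]≡a : ∀ a b → - b - - (a + b) ≡ a
              -b--[a+b]≡a = solve-∀
      k-[m′+n]≤m″ : k - (m′ + n) ≤ m″
      k-[m′+n]≤m″ = subst (k - (m′ + n) ≤_) ([a+b]+n-[a+n]≡b m′ m″ n) (ℤP.+-monoˡ-≤ (- (m′ + n)) k≤m+n)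
        where [a+b]+n-[a+n]≡b : ∀ a b n → (a + b) + n - (a + n) ≡ b
              [a+b]+n-[a+n]≡b = solve-∀

  isDistProd-Pcross : IsDistProd (Psp a′ b P′ ⊔ᴹ Pss a′ b P′) (Pss a″ b P″ ⊔ᴹ Pps a″ b P″) (Pcross a′ a″ b P)
  isDistProd-Pcross = refl , refl , sym -m′⊓0≡-m′ , sym 0⊔n≡n , sym 0⊓n≡0 , sym n⊔[m″+n]≡m″+n ,
    sub-isSubPerm (swMat (a′ ++ a″) b P) (proj₁ S) -a≤-m′ (ℤP.≤-trans (-d≤0 _) 0≤n) ℤP.≤-refl
                  ℤP.≤-refl (0≤+d _) m″+n≤a+n ,
    λ i k i≥ i≤ k≥ k≤ → trans (distΣ-Pcross≡minR (subst (_≤ i) -m′⊓0≡-m′ i≥) (subst (i ≤_) 0⊔n≡n i≤)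
                                                  (subst (_≤ k) 0⊓n≡0 k≥) (subst (k ≤_) n⊔[m″+n]≡m″+n k≤))
                              (cong (minR _ 0ℤ) (sym (ℤP.⊔-idem n)))
    where
    -m′⊓0≡-m′     = ℤP.i≤j⇒i⊓j≡i (-d≤0 (length a′))
    0⊔n≡n         = ℤP.i≤j⇒i⊔j≡j 0≤n
    0⊓n≡0         = ℤP.i≤j⇒i⊓j≡i 0≤n
    n⊔[m″+n]≡m″+n = ℤP.i≤j⇒i⊔j≡j (ℤP.i≤j+i n m″)

  isDistProd-swMat : IsDistProd (offId (- (m′ + m″)) (- m′) (- m″) 0ℤ ⊔ᴹ swMat a′ b P′)
                                (swMat a″ b P″ ⊔ᴹ offId n (m′ + n) (m″ + n) ((m′ + m″) + n))
                                (swMat (a′ ++ a″) b P)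
  isDistProd-swMat =
    trans -m″⊓0≡-m″ (sym -m″⊓n≡-m″) , trans 0⊔[m′+n]≡m′+n (sym n⊔[m′+n]≡m′+n) ,
    trans (cong -_ length-a≡) (sym -m⊓-m′≡-m) , sym -m′⊔n≡n ,
    sym 0⊓[m″+n]≡0 , trans (cong (_+ n) length-a≡) (sym [m″+n]⊔[m+n]≡m+n) ,
    isPerm⇒isSubPerm (proj₁ S) ,
    λ i k i≥ i≤ k≥ k≤ → trans (distΣ-swMat≡minR (subst (_≤ i) -m⊓-m′≡-m i≥) (subst (i ≤_) -m′⊔n≡n i≤)
                                                 (subst (_≤ k) 0⊓[m″+n]≡0 k≥) (subst (k ≤_) [m″+n]⊔[m+n]≡m+n k≤))
                              (sym (cong₂ (minR _) -m″⊓0≡-m″ 0⊔[m′+n]≡m′+n))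
    where
    -m″≤0 = -d≤0 (length a″)
    n≤m′+n = ℤP.i≤j+i n m′
    -m″⊓0≡-m″        = ℤP.i≤j⇒i⊓j≡i -m″≤0
    -m″⊓n≡-m″        = ℤP.i≤j⇒i⊓j≡i (ℤP.≤-trans -m″≤0 0≤n)
    0⊔[m′+n]≡m′+n    = ℤP.i≤j⇒i⊔j≡j (ℤP.≤-trans 0≤n n≤m′+n)
    n⊔[m′+n]≡m′+n    = ℤP.i≤j⇒i⊔j≡j n≤m′+n
    -m⊓-m′≡-m        = ℤP.i≤j⇒i⊓j≡i (ℤP.neg-mono-≤ (ℤP.i≤i+j m′ m″))
    -m′⊔n≡n          = ℤP.i≤j⇒i⊔j≡j (ℤP.≤-trans (-d≤0 (length a′)) 0≤n)
    0⊓[m″+n]≡0       = ℤP.i≤j⇒i⊓j≡i (ℤP.≤-trans 0≤n (ℤP.i≤j+i n m″))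
    [m″+n]⊔[m+n]≡m+n = ℤP.i≤j⇒i⊔j≡j (ℤP.+-monoˡ-≤ n (ℤP.i≤j+i m″ m′))

theorem3p18 : {A : Set} (a′ a″ b : List A) →
    a′ ≢ [] → a″ ≢ [] → b ≢ [] →
    (P P′ P″ : ℤ → ℤ → ℤ) →
    IsSeaweed (a′ ++ a″) b P → IsSeaweed a′ b P′ → IsSeaweed a″ b P″ →
    let m′ = + length a′
        m″ = + length a″
        n = + length b
        m = m′ + m″
        Im′ = offId (- m) (- m′) (- m″) 0ℤ
        Im″ = offId n (m′ + n) (m″ + n) (m + n)
    in IsDistProd (Im′ ⊔ᴹ swMat a′ b P′) (swMat a″ b P″ ⊔ᴹ Im″) (swMat (a′ ++ a″) b P)
       × IsDistProd (Pss a′ b P′) (Pss a″ b P″) (Pss (a′ ++ a″) b P)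
       × IsDistProd (Psp a′ b P′ ⊔ᴹ Pss a′ b P′) (Pss a″ b P″ ⊔ᴹ Pps a″ b P″)
                    (Pcross a′ a″ b P)
theorem3p18 a′ a″ b _ _ _ P P′ P″ S S′ S″ =
  isDistProd-swMat a′ a″ b P P′ P″ S S′ S″ ,
  isDistProd-Pss a′ a″ b P P′ P″ S S′ S″ ,
  isDistProd-Pcross a′ a″ b P P′ P″ S S′ S″
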